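{- Let $n>1$ be an integer all of whose components are congruent to $1$ modulo $4$. Then there exists a doubly disjoint $(\mathbb Z_3\times V_n,\mathbb Z_3\times\{0\},3,1)$ difference family.
   Context: A component of an integer is a maximal prime power dividing it. For $N$ with components $q_1,\dots,q_\omega$, $V_N$ is the additive group of $\mathbb F_{q_1}\times\dots\times\mathbb F_{q_\omega}$. For a subgroup $H$ of an abelian group $G$, a $(G,H,3,1)$ difference family is a family $\mathcal F$ of $3$-subsets of $G$ such that the multiset of differences $x-y$, over ordered pairs of distinct elements of a common block, equals $G\setminus H$ (each element exactly once). Two such families are strongly equivalent if each block of one is a translate $B+t$ of a block $B$ of the other (blocks in one-to-one correspondence). A $(G,H,3,1)$ difference family $\mathcal F$ is doubly disjoint if there is a $(G,H,3,1)$ difference family $\mathcal F'$ strongly equivalent to $\mathcal F$ such that the blocks of $\mathcal F$ together with those of $\mathcal F'$ form a partition of $G\setminus H$. -}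

module Defs where

open import Data.Nat using (ℕ; zero; suc; _+_; _*_; _∸_; _^_; _≤_; _<_; NonZero)
open import Data.Nat.DivMod using (_mod_)
open import Data.Nat.Divisibility using (_∣_)
open import Data.Nat.Primality using (Prime; prime⇒nonZero)
open import Data.Fin as Fin using (Fin; toℕ)
open import Data.Vec as Vec using (Vec; []; _∷_)
import Data.Vec.Properties as VecP
open import Data.List as List using (List; []; _∷_; length; filter; map; concatMap; zipWith; _++_)
open import Data.List.Membership.Propositional using (_∈_)
open import Data.List.Relation.Unary.Unique.Propositional using (Unique)
open import Data.List.Relation.Binary.Permutation.Propositional using (_↭_)
open import Data.List.Relation.Binary.Pointwise using (Pointwise)
open import Data.Product using (Σ; ∃; _×_; _,_; proj₁; proj₂)
open import Data.Product.Properties using (≡-dec)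
open import Data.Unit using (⊤; tt)
open import Data.Bool using (if_then_else_)
open import Relation.Nullary using (¬_; yes; no; Dec)
open import Relation.Nullary.Decidable using (⌊_⌋)
open import Relation.Binary.PropositionalEquality using (_≡_; _≢_; refl)
open import Relation.Binary.Definitions using (DecidableEquality)

IsComponent : ℕ → ℕ → Set
IsComponent q n =
  Σ ℕ λ p → Σ ℕ λ e → Prime p × 1 ≤ e × q ≡ p ^ e × q ∣ n × ¬ (p * q ∣ n)

record Comp : Set where
  constructor comp
  field
    p     : ℕ
    e     : ℕ
    prime : Prime p

open Comp public

qOf : Comp → ℕ
qOf c = p c ^ e c

ListsComponentsOf : List Comp → ℕ → Set
ListsComponentsOf cs n =
  (∀ c → c ∈ cs → 1 ≤ e c × IsComponent (qOf c) n)
  × Unique (map qOf cs)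
  × (∀ q → IsComponent q n → q ∈ map qOf cs)

module _ {m : ℕ} .{{_ : NonZero m}} where
  _+ₘ_ : Fin m → Fin m → Fin m
  a +ₘ b = (toℕ a + toℕ b) mod m

  -ₘ_ : Fin m → Fin m
  -ₘ a = (m ∸ toℕ a) mod m

  0ₘ : Fin m
  0ₘ = 0 mod m

-- Additive group of F_q, q = p^e : (Z_p)^e  (componentwise mod p)

Fq : Comp → Set
Fq c = Vec (Fin (p c)) (e c)

module _ (c : Comp) where
  private instance nz : NonZero (p c)
                   nz = prime⇒nonZero (prime c)
  addF : Fq c → Fq c → Fq c
  addF = Vec.zipWith _+ₘ_
  negF : Fq c → Fq c
  negF = Vec.map -ₘ_
  zeroF : Fq c
  zeroF = Vec.replicate (e c) 0ₘ

decF : (c : Comp) → DecidableEquality (Fq c)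
decF c = VecP.≡-dec Fin._≟_

V : List Comp → Set
V []       = ⊤
V (c ∷ cs) = Fq c × V cs

addV : (cs : List Comp) → V cs → V cs → V cs
addV []       _        _        = tt
addV (c ∷ cs) (x , xs) (y , ys) = addF c x y , addV cs xs ys

negV : (cs : List Comp) → V cs → V cs
negV []       _        = tt
negV (c ∷ cs) (x , xs) = negF c x , negV cs xs

zeroV : (cs : List Comp) → V cs
zeroV []       = tt
zeroV (c ∷ cs) = zeroF c , zeroV cs

decV : (cs : List Comp) → DecidableEquality (V cs)
decV []       tt tt = yes refl
decV (c ∷ cs)       = ≡-dec (decF c) (decV cs)

G : List Comp → Set
G cs = Fin 3 × V cs

_+G_ : {cs : List Comp} → G cs → G cs → G cs
_+G_ {cs} (a , x) (b , y) = a +ₘ b , addV cs x y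

_-G_ : {cs : List Comp} → G cs → G cs → G cs
_-G_ {cs} (a , x) (b , y) = a +ₘ (-ₘ b) , addV cs x (negV cs y)

decG : (cs : List Comp) → DecidableEquality (G cs)
decG cs = ≡-dec Fin._≟_ (decV cs)

indG∖H : (cs : List Comp) → G cs → ℕ
indG∖H cs (a , x) = if ⌊ decV cs x (zeroV cs) ⌋ then 0 else 1

count : (cs : List Comp) → G cs → List (G cs) → ℕ
count cs g xs = length (filter (decG cs g) xs)

record Block (cs : List Comp) : Set where
  constructor block
  field
    b₁ b₂ b₃ : G cs
    d₁₂ : b₁ ≢ b₂
    d₁₃ : b₁ ≢ b₃
    d₂₃ : b₂ ≢ b₃

open Block public

elems : {cs : List Comp} → Block cs → List (G cs)
elems B = b₁ B ∷ b₂ B ∷ b₃ B ∷ []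

diffs : {cs : List Comp} → Block cs → List (G cs)
diffs B =
  (b₁ B -G b₂ B) ∷ (b₂ B -G b₁ B) ∷ (b₁ B -G b₃ B) ∷
  (b₃ B -G b₁ B) ∷ (b₂ B -G b₃ B) ∷ (b₃ B -G b₂ B) ∷ []

-- (G, H, 3, 1) difference family (family = list of blocks, a multiset)
IsDF : (cs : List Comp) → List (Block cs) → Set
IsDF cs F = ∀ (g : G cs) → count cs g (concatMap diffs F) ≡ indG∖H cs g

IsTranslateOf : {cs : List Comp} → Block cs → Block cs → Set
IsTranslateOf {cs} B' B = Σ (G cs) λ t → elems B' ↭ map (_+G t) (elems B)

-- strongly equivalent: blocks in one-to-one correspondence (matched in
-- list order), each block of F' a translate of the corresponding block of F
StronglyEquivalent : {cs : List Comp} → List (Block cs) → List (Block cs) → Set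
StronglyEquivalent F' F = Pointwise IsTranslateOf F' F

PartitionsG∖H : (cs : List Comp) → List (Block cs) → Set
PartitionsG∖H cs F = ∀ (g : G cs) → count cs g (concatMap elems F) ≡ indG∖H cs g

DoublyDisjoint : (cs : List Comp) → List (Block cs) → Set
DoublyDisjoint cs F =
  Σ (List (Block cs)) λ F' →
    IsDF cs F' × StronglyEquivalent F' F × PartitionsG∖H cs (F ++ F')

-- Write V for V_n.  Because every component q = p^e of n is 1 mod 4, V carries an additive map i with
-- i ∘ i = -1: multiplication by a square root of -1 in F_p when e is odd (then p ≡ 1 mod 4), and the
-- rotation (a, b) ↦ (-b, a) on pairs of coordinates when e is even; doubling is invertible as p is odd.
-- The units ±1, ±i then act freely on V ∖ {0}.  For each representative x of their orbits, take the blocks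
-- {(0, ix + x), (0, ix - x), (2, ix)} and {(1, -x + ix), (1, -x - ix), (2, -x)}, and as their translates
-- the same blocks with ix and -x replaced by -ix and x.  On each level of ℤ₃ the differences of the two
-- blocks of x form one orbit (of 2x on level 0, of x on levels 1 and 2), and the elements of all four
-- blocks form one orbit (of (1 + i)x on levels 0 and 1, of x on level 2).  Since 2 and 1 + i are
-- invertible and commute with the units, both families are difference families and together they
-- partition (ℤ₃ × V) ∖ (ℤ₃ × {0}).

module Submission where

open import Defs hiding (count)
open import Algebra.Bundles using (AbelianGroup; CommutativeRing)
open import Algebra.Definitions using (Associative; Commutative; RightIdentity; RightInverse)
import Algebra.Properties.AbelianGroup as AbelianGroupProperties
import Algebra.Properties.CommutativeSemigroup as CommutativeSemigroupProperties
import Algebra.Properties.Ring as RingProperties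
open import Algebra.Structures using (IsAbelianGroup; IsCommutativeRing)
open import Data.Bool as Bool using (Bool; true; false; not; _xor_; _∧_; if_then_else_)
open import Data.Bool.Properties using (xor-same; not-distribˡ-xor; not-distribʳ-xor)
open import Data.Empty using (⊥-elim)
open import Data.Fin as Fin using (Fin; toℕ)
open import Data.Fin.Patterns using (0F; 1F; 2F)
open import Data.Fin.Properties using (toℕ-fromℕ<; toℕ-injective; toℕ<n; suc-injective; any?)
open import Data.List as List
  using (List; []; _∷_; _++_; [_]; length; map; filter; concatMap; cartesianProductWith; allFin; tabulate)
open import Data.List.Membership.Propositional using (_∈_; lose)
open import Data.List.Properties
  using ( map-cong; map-∘; map-++; map-concatMap; map-tabulate; concatMap-++; concatMap-cong
        ; filter-accept; filter-reject; filter-++; length-++; length-map; length-tabulate; ++-identityʳ)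
import Data.List.Relation.Binary.Pointwise as Pointwise
open import Data.List.Relation.Binary.Permutation.Propositional using (↭-reflexive)
open import Data.List.Relation.Unary.Any as Any using (here; there)
open import Data.Nat as ℕ using (ℕ; zero; suc; NonZero; _%_; _^_; _<_; _≤_)
open import Data.Nat.Coprimality using (Coprime; coprime-Bézout)
open import Data.Nat.DivMod
  using ( _mod_; %-distribˡ-+; %-distribˡ-*; m%n%n≡m%n; m<n⇒m%n≡m; n%n≡0; [m+n]%n≡m%n; [m+kn]%n≡m%n
        ; m*n%n≡0; m∣n⇒o%n%m≡o%m)
open import Data.Nat.Divisibility using (_∣_; divides; m%n≡0⇒n∣m; ∣⇒≤)
open import Data.Nat.GCD using (module Bézout)
open import Data.Nat.ListAction using (sum)
open import Data.Nat.Primality using (Prime; prime⇒nonZero; prime⇒nonTrivial; prime⇒irreducible; euclidsLemma)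
import Data.Nat.Properties as ℕ
open import Data.Nat.Solver using (module +-*-Solver)
open import Data.Product using (Σ; ∃; _×_; _,_; proj₁; proj₂)
open import Data.Product.Properties using (≡-dec)
open import Data.Sum using (_⊎_; inj₁; inj₂)
open import Data.Unit using (tt)
open import Data.Vec as Vec using (Vec; []; _∷_)
import Data.Vec.Properties as Vec
open import Function using (_∘_; _∘′_; _$_; id; Injective)
open import Relation.Binary.Definitions using (DecidableEquality)
open import Relation.Binary.PropositionalEquality
  using (_≡_; _≢_; refl; sym; trans; cong; cong₂; subst; isEquivalence; module ≡-Reasoning)
open import Relation.Nullary using (¬_; Dec; yes; no; contradiction)
open import Relation.Nullary.Decidable using (map′; _×-dec_; _⊎-dec_; ¬?; ⌊_⌋)
open import Relation.Unary using (Decidable)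

open ≡-Reasoning

module Count {A : Set} (_≟_ : DecidableEquality A) where

  open import Data.Nat using (_+_)
  open import Algebra.Properties.CommutativeSemigroup ℕ.+-commutativeSemigroup using (interchange)

  count : A → List A → ℕ
  count x xs = length (filter (x ≟_) xs)

  count-here : ∀ x xs → count x (x ∷ xs) ≡ suc (count x xs)
  count-here x xs = cong length (filter-accept (x ≟_) refl)

  count-there : ∀ x y xs → x ≢ y → count x (y ∷ xs) ≡ count x xs
  count-there x y xs x≢y = cong length (filter-reject (x ≟_) x≢y)

  count-++ : ∀ x xs ys → count x (xs ++ ys) ≡ count x xs + count x ys
  count-++ x xs ys = trans (cong length (filter-++ (x ≟_) xs ys)) (length-++ (filter (x ≟_) xs))

  count-map-∉ : ∀ {B : Set} x (f : B → A) bs → (∀ b → x ≢ f b) → count x (map f bs) ≡ 0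
  count-map-∉ x f []       x∉f = refl
  count-map-∉ x f (b ∷ bs) x∉f = trans (count-there x (f b) (map f bs) (x∉f b)) (count-map-∉ x f bs x∉f)

  count-singleton-sym : ∀ x y → count x [ y ] ≡ count y [ x ]
  count-singleton-sym x y = by-cases (x ≟ y)
    where
    by-cases : Dec (x ≡ y) → count x [ y ] ≡ count y [ x ]
    by-cases (yes refl) = refl
    by-cases (no x≢y)   = trans (count-there x y [] x≢y) (sym (count-there y x [] (x≢y ∘ sym)))

  count≢0⇒∈ : ∀ {x} xs → count x xs ≢ 0 → x ∈ xs
  count≢0⇒∈ {x} []       c≢0 = ⊥-elim (c≢0 refl)
  count≢0⇒∈ {x} (y ∷ xs) c≢0 = by-cases (x ≟ y)
    where
    by-cases : Dec (x ≡ y) → x ∈ y ∷ xs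
    by-cases (yes x≡y) = here x≡y
    by-cases (no x≢y)  = there (count≢0⇒∈ xs (c≢0 ∘ trans (count-there x y xs x≢y)))

  count-concatMap-++ : ∀ {B : Set} x (f g : B → List A) bs →
                       count x (concatMap f bs) + count x (concatMap g bs) ≡ count x (concatMap (λ b → f b ++ g b) bs)
  count-concatMap-++ x f g []       = refl
  count-concatMap-++ x f g (b ∷ bs) = begin
    count x (f b ++ concatMap f bs) + count x (g b ++ concatMap g bs)
      ≡⟨ cong₂ _+_ (count-++ x (f b) _) (count-++ x (g b) _) ⟩
    (count x (f b) + count x (concatMap f bs)) + (count x (g b) + count x (concatMap g bs))
      ≡⟨ interchange (count x (f b)) _ _ _ ⟩
    (count x (f b) + count x (g b)) + (count x (concatMap f bs) + count x (concatMap g bs))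
      ≡⟨ cong₂ _+_ (count-++ x (f b) (g b)) (sym (count-concatMap-++ x f g bs)) ⟨
    count x (f b ++ g b) + count x (concatMap (λ b → f b ++ g b) bs)
      ≡⟨ count-++ x (f b ++ g b) _ ⟨
    count x ((f b ++ g b) ++ concatMap (λ b → f b ++ g b) bs)
      ∎

  IsEnumeration : List A → Set
  IsEnumeration xs = ∀ x → count x xs ≡ 1

  ∈-enumeration : ∀ xs → IsEnumeration xs → ∀ x → x ∈ xs
  ∈-enumeration xs enum x = count≢0⇒∈ xs (λ c≡0 → ℕ.1+n≢0 (trans (sym (enum x)) c≡0))

  sum-count : ∀ ys → IsEnumeration ys → ∀ xs → sum (map (λ y → count y xs) ys) ≡ length xs
  sum-count ys enum []       = sum-zeros ys
    where
    sum-zeros : ∀ zs → sum (map (λ _ → 0) zs) ≡ 0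
    sum-zeros []       = refl
    sum-zeros (_ ∷ zs) = sum-zeros zs
  sum-count ys enum (x ∷ xs) = begin
    sum (map (λ y → count y (x ∷ xs)) ys)
      ≡⟨ cong sum (map-cong (λ y → count-++ y [ x ] xs) ys) ⟩
    sum (map (λ y → count y [ x ] + count y xs) ys)
      ≡⟨ sum-map-+ ys ⟩
    sum (map (λ y → count y [ x ]) ys) + sum (map (λ y → count y xs) ys)
      ≡⟨ cong₂ _+_ (sum-singleton ys) (sum-count ys enum xs) ⟩
    count x ys + length xs
      ≡⟨ cong (_+ length xs) (enum x) ⟩
    suc (length xs)
      ∎
    where
    sum-map-+ : ∀ zs → sum (map (λ y → count y [ x ] + count y xs) zs)
                       ≡ sum (map (λ y → count y [ x ]) zs) + sum (map (λ y → count y xs) zs)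
    sum-map-+ []       = refl
    sum-map-+ (z ∷ zs) = trans (cong (count z [ x ] + count z xs +_) (sum-map-+ zs))
                               (interchange (count z [ x ]) (count z xs) _ _)
    sum-singleton : ∀ zs → sum (map (λ y → count y [ x ]) zs) ≡ count x zs
    sum-singleton []       = refl
    sum-singleton (z ∷ zs) = trans (cong₂ _+_ (count-singleton-sym z x) (sum-singleton zs))
                                   (sym (count-++ x [ z ] zs))

  enumeration-length : ∀ xs ys → IsEnumeration xs → IsEnumeration ys → length xs ≡ length ys
  enumeration-length xs ys xs-enum ys-enum =
    trans (sym (sum-count ys ys-enum xs))
          (trans (cong sum (map-cong (λ y → trans (xs-enum y) (sym (ys-enum y))) ys)) (sum-count ys ys-enum ys))

module _ {A B : Set} (_≟A_ : DecidableEquality A) (_≟B_ : DecidableEquality B) where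
  private
    module A = Count _≟A_
    module B = Count _≟B_

  count-map-injective : ∀ (f : B → A) → Injective _≡_ _≡_ f → ∀ b bs → A.count (f b) (map f bs) ≡ B.count b bs
  count-map-injective f f-inj b []        = refl
  count-map-injective f f-inj b (b′ ∷ bs) = by-cases (b ≟B b′)
    where
    by-cases : Dec (b ≡ b′) → A.count (f b) (map f (b′ ∷ bs)) ≡ B.count b (b′ ∷ bs)
    by-cases (yes refl) = trans (A.count-here (f b) (map f bs))
                                (trans (cong suc (count-map-injective f f-inj b bs)) (sym (B.count-here b bs)))
    by-cases (no b≢b′)  = trans (A.count-there (f b) (f b′) (map f bs) (b≢b′ ∘ f-inj))
                                (trans (count-map-injective f f-inj b bs) (sym (B.count-there b b′ bs b≢b′)))

module _ {A B C : Set} (_≟A_ : DecidableEquality A) (_≟B_ : DecidableEquality B) (_≟C_ : DecidableEquality C)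
         (f : A → B → C) (f-injective : ∀ {a b a′ b′} → f a b ≡ f a′ b′ → a ≡ a′ × b ≡ b′) where

  open import Data.Nat using (_+_; _*_)
  private
    module A = Count _≟A_
    module B = Count _≟B_
    module C = Count _≟C_

  count-cartesianProductWith : ∀ a b as bs →
    C.count (f a b) (cartesianProductWith f as bs) ≡ A.count a as * B.count b bs
  count-cartesianProductWith a b []        bs = refl
  count-cartesianProductWith a b (a′ ∷ as) bs = begin
    C.count (f a b) (map (f a′) bs ++ cartesianProductWith f as bs)
      ≡⟨ C.count-++ (f a b) (map (f a′) bs) _ ⟩
    C.count (f a b) (map (f a′) bs) + C.count (f a b) (cartesianProductWith f as bs)
      ≡⟨ cong₂ _+_ (count-row (a ≟A a′)) (count-cartesianProductWith a b as bs) ⟩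
    A.count a [ a′ ] * B.count b bs + A.count a as * B.count b bs
      ≡⟨ ℕ.*-distribʳ-+ (B.count b bs) (A.count a [ a′ ]) (A.count a as) ⟨
    (A.count a [ a′ ] + A.count a as) * B.count b bs
      ≡⟨ cong (_* B.count b bs) (A.count-++ a [ a′ ] as) ⟨
    A.count a (a′ ∷ as) * B.count b bs
      ∎
    where
    count-row : Dec (a ≡ a′) → C.count (f a b) (map (f a′) bs) ≡ A.count a [ a′ ] * B.count b bs
    count-row (yes refl) = trans (count-map-injective _≟C_ _≟B_ (f a) (proj₂ ∘ f-injective) b bs)
                                 (sym (trans (cong (_* B.count b bs) (A.count-here a [])) (ℕ.+-identityʳ (B.count b bs))))
    count-row (no a≢a′)  = trans (C.count-map-∉ (f a b) (f a′) bs (λ b′ → a≢a′ ∘ proj₁ ∘ f-injective))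
                                 (cong (_* B.count b bs) (sym (A.count-there a a′ [] a≢a′)))

allFin-enumeration : ∀ n → Count.IsEnumeration Fin._≟_ (allFin n)
allFin-enumeration (suc n) Fin.zero    = cong suc (trans (cong (count Fin.zero) (sym (map-tabulate id Fin.suc)))
                                                          (count-map-∉ Fin.zero Fin.suc (allFin n) (λ _ ())))
  where open Count Fin._≟_
allFin-enumeration (suc n) (Fin.suc i) = begin
  count (Fin.suc i) (Fin.zero ∷ tabulate Fin.suc)  ≡⟨ count-there (Fin.suc i) Fin.zero (tabulate Fin.suc) (λ ()) ⟩
  count (Fin.suc i) (tabulate Fin.suc)             ≡⟨ cong (count (Fin.suc i)) (map-tabulate id Fin.suc) ⟨
  count (Fin.suc i) (map Fin.suc (allFin n))       ≡⟨ count-map-injective Fin._≟_ Fin._≟_ Fin.suc suc-injective i (allFin n) ⟩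
  Count.count Fin._≟_ i (allFin n)                 ≡⟨ allFin-enumeration n i ⟩
  1                                                ∎
  where open Count Fin._≟_

allVec : ∀ {A : Set} → List A → ∀ n → List (Vec A n)
allVec xs zero    = [ [] ]
allVec xs (suc n) = cartesianProductWith _∷_ xs (allVec xs n)

allVec-enumeration : ∀ {A : Set} (_≟_ : DecidableEquality A) xs → Count.IsEnumeration _≟_ xs →
                     ∀ n → Count.IsEnumeration (Vec.≡-dec _≟_) (allVec xs n)
allVec-enumeration _≟_ xs xs-enum zero    []      = refl
allVec-enumeration _≟_ xs xs-enum (suc n) (x ∷ v) =
  trans (count-cartesianProductWith _≟_ (Vec.≡-dec _≟_) (Vec.≡-dec _≟_) _∷_ Vec.∷-injective x v xs (allVec xs n))
        (cong₂ ℕ._*_ (xs-enum x) (allVec-enumeration _≟_ xs xs-enum n v))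

allV : ∀ cs → List (V cs)
allV []       = [ tt ]
allV (c ∷ cs) = cartesianProductWith _,_ (allVec (allFin (p c)) (e c)) (allV cs)

allV-enumeration : ∀ cs → Count.IsEnumeration (decV cs) (allV cs)
allV-enumeration []       tt      = refl
allV-enumeration (c ∷ cs) (x , v) =
  trans (count-cartesianProductWith (decF c) (decV cs) (decV (c ∷ cs)) _,_ ,-injective x v (allVec (allFin (p c)) (e c)) (allV cs))
        (cong₂ ℕ._*_ (allVec-enumeration Fin._≟_ (allFin (p c)) (allFin-enumeration (p c)) (e c) x)
                   (allV-enumeration cs v))
  where
  ,-injective : ∀ {x y x′ y′} → _≡_ {A = V (c ∷ cs)} (x , y) (x′ , y′) → x ≡ x′ × y ≡ y′
  ,-injective refl = refl , refl

concatMap-concatMap : ∀ {A B C : Set} (f : B → List C) (g : A → List B) xs →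
                      concatMap f (concatMap g xs) ≡ concatMap (concatMap f ∘ g) xs
concatMap-concatMap f g []       = refl
concatMap-concatMap f g (x ∷ xs) =
  trans (concatMap-++ f (g x) (concatMap g xs)) (cong (concatMap f (g x) ++_) (concatMap-concatMap f g xs))

module _ {A B : Set} (_≟A_ : DecidableEquality A) (_≟B_ : DecidableEquality B) where
  private
    module B  = Count _≟B_
    module AB = Count (≡-dec _≟A_ _≟B_)

  atLevel : A → List (A × B) → List B
  atLevel a = map proj₂ ∘ filter ((a ≟A_) ∘ proj₁)

  count-atLevel : ∀ a b xs → AB.count (a , b) xs ≡ B.count b (atLevel a xs)
  count-atLevel a b []                = refl
  count-atLevel a b ((a′ , b′) ∷ xs) = by-cases (a ≟A a′) (b ≟B b′)
    where
    accept : a ≡ a′ → atLevel a ((a′ , b′) ∷ xs) ≡ b′ ∷ atLevel a xs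
    accept a≡a′ = cong (map proj₂) (filter-accept ((a ≟A_) ∘ proj₁) a≡a′)
    by-cases : Dec (a ≡ a′) → Dec (b ≡ b′) →
               AB.count (a , b) ((a′ , b′) ∷ xs) ≡ B.count b (atLevel a ((a′ , b′) ∷ xs))
    by-cases (no a≢a′)  _          = begin
      AB.count (a , b) ((a′ , b′) ∷ xs)     ≡⟨ AB.count-there (a , b) (a′ , b′) xs (a≢a′ ∘ cong proj₁) ⟩
      AB.count (a , b) xs                   ≡⟨ count-atLevel a b xs ⟩
      B.count b (atLevel a xs)              ≡⟨ cong (B.count b ∘ map proj₂) (filter-reject ((a ≟A_) ∘ proj₁) a≢a′) ⟨
      B.count b (atLevel a ((a′ , b′) ∷ xs)) ∎
    by-cases (yes refl) (yes refl) = begin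
      AB.count (a , b) ((a , b) ∷ xs)       ≡⟨ AB.count-here (a , b) xs ⟩
      suc (AB.count (a , b) xs)             ≡⟨ cong suc (count-atLevel a b xs) ⟩
      suc (B.count b (atLevel a xs))        ≡⟨ B.count-here b (atLevel a xs) ⟨
      B.count b (b ∷ atLevel a xs)          ≡⟨ cong (B.count b) (accept refl) ⟨
      B.count b (atLevel a ((a , b) ∷ xs))  ∎
    by-cases (yes refl) (no b≢b′)  = begin
      AB.count (a , b) ((a , b′) ∷ xs)      ≡⟨ AB.count-there (a , b) (a , b′) xs (b≢b′ ∘ cong proj₂) ⟩
      AB.count (a , b) xs                   ≡⟨ count-atLevel a b xs ⟩
      B.count b (atLevel a xs)              ≡⟨ B.count-there b b′ (atLevel a xs) b≢b′ ⟨
      B.count b (b′ ∷ atLevel a xs)         ≡⟨ cong (B.count b) (accept refl) ⟨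
      B.count b (atLevel a ((a , b′) ∷ xs)) ∎

  atLevel-++ : ∀ a xs ys → atLevel a (xs ++ ys) ≡ atLevel a xs ++ atLevel a ys
  atLevel-++ a xs ys = trans (cong (map proj₂) (filter-++ ((a ≟A_) ∘ proj₁) xs ys))
                             (map-++ proj₂ (filter ((a ≟A_) ∘ proj₁) xs) (filter ((a ≟A_) ∘ proj₁) ys))

  atLevel-concatMap : ∀ {C : Set} a (f : C → List (A × B)) zs → atLevel a (concatMap f zs) ≡ concatMap (atLevel a ∘ f) zs
  atLevel-concatMap a f []       = refl
  atLevel-concatMap a f (z ∷ zs) =
    trans (atLevel-++ a (f z) (concatMap f zs)) (cong (atLevel a (f z) ++_) (atLevel-concatMap a f zs))

-- Orbits of free actions

record FreeAction (K : Set) {A : Set} (D : A → Set) : Set where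
  infixl 7 _·_
  infix 8 _⁻¹
  field
    act              : K → A → A
    ε                : K
    _·_              : K → K → K
    _⁻¹              : K → K
    act-ε            : ∀ x → act ε x ≡ x
    act-·            : ∀ k l x → act k (act l x) ≡ act (k · l) x
    act-⁻¹           : ∀ k x → act (k ⁻¹) (act k x) ≡ x
    ⁻¹-cancel        : ∀ k l → l ⁻¹ · k ≡ ε → k ≡ l
    act-D            : ∀ k {x} → D x → D (act k x)
    fixed-point-free : ∀ k {x} → D x → act k x ≡ x → k ≡ ε

  free : ∀ {x} → D x → ∀ k l → act k x ≡ act l x → k ≡ l
  free {x} Dx k l kx≡lx = ⁻¹-cancel k l (fixed-point-free (l ⁻¹ · k) Dx (begin
    act (l ⁻¹ · k) x      ≡⟨ act-· (l ⁻¹) k x ⟨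
    act (l ⁻¹) (act k x)  ≡⟨ cong (act (l ⁻¹)) kx≡lx ⟩
    act (l ⁻¹) (act l x)  ≡⟨ act-⁻¹ l x ⟩
    x                     ∎))

-- The representative of an orbit is its first element in the enumeration `as`.
module Orbits {K A : Set} (_≟ₖ_ : DecidableEquality K) (_≟_ : DecidableEquality A)
              {D : A → Set} (D? : Decidable D) (𝒜 : FreeAction K D)
              (ks : List K) (ks-enum : Count.IsEnumeration _≟ₖ_ ks)
              (as : List A) (as-enum : Count.IsEnumeration _≟_ as) where

  open FreeAction 𝒜
  open Count _≟_
  open import Data.Nat using (_+_; _*_)
  private module K = Count _≟ₖ_

  infix 4 _∼_ _∼?_

  _∼_ : A → A → Set
  v ∼ x = ∃ λ k → v ≡ act k x

  ∼-refl : ∀ x → x ∼ x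
  ∼-refl x = ε , sym (act-ε x)

  ∼-sym : ∀ {v x} → v ∼ x → x ∼ v
  ∼-sym {v} {x} (k , v≡kx) = k ⁻¹ , trans (sym (act-⁻¹ k x)) (cong (act (k ⁻¹)) (sym v≡kx))

  ∼-trans : ∀ {u v x} → u ∼ v → v ∼ x → u ∼ x
  ∼-trans {x = x} (k , u≡kv) (l , v≡lx) = k · l , trans u≡kv (trans (cong (act k) v≡lx) (act-· k l x))

  _∼?_ : ∀ v x → Dec (v ∼ x)
  v ∼? x = map′ Any.satisfied (λ (k , v≡kx) → lose (K.∈-enumeration ks ks-enum k) v≡kx)
                (Any.any? (λ k → v ≟ act k x) ks)

  D-∼ : ∀ {v x} → v ∼ x → D x → D v
  D-∼ (k , refl) = act-D k

  firstInOrbit : A → List A → A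
  firstInOrbit v []       = v
  firstInOrbit v (w ∷ ws) with w ∼? v
  ... | yes _ = w
  ... | no _  = firstInOrbit v ws

  firstInOrbit-∼ : ∀ v ws → firstInOrbit v ws ∼ v
  firstInOrbit-∼ v []       = ∼-refl v
  firstInOrbit-∼ v (w ∷ ws) with w ∼? v
  ... | yes w∼v = w∼v
  ... | no _    = firstInOrbit-∼ v ws

  firstInOrbit-cong : ∀ {v v′} ws → v ∼ v′ → v ∈ ws → firstInOrbit v ws ≡ firstInOrbit v′ ws
  firstInOrbit-cong {v} {v′} (w ∷ ws) v∼v′ v∈ws with w ∼? v | w ∼? v′
  ... | yes _   | yes _    = refl
  ... | yes w∼v | no w≁v′  = contradiction (∼-trans w∼v v∼v′) w≁v′
  ... | no w≁v  | yes w∼v′ = contradiction (∼-trans w∼v′ (∼-sym v∼v′)) w≁v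
  ... | no w≁v  | no _     with v∈ws
  ...   | Any.here refl  = contradiction (∼-refl v) w≁v
  ...   | Any.there v∈ws′ = firstInOrbit-cong ws v∼v′ v∈ws′

  rep : A → A
  rep v = firstInOrbit v as

  rep-∼ : ∀ v → rep v ∼ v
  rep-∼ v = firstInOrbit-∼ v as

  rep-cong : ∀ {v v′} → v ∼ v′ → rep v ≡ rep v′
  rep-cong {v} v∼v′ = firstInOrbit-cong as v∼v′ (∈-enumeration as as-enum v)

  IsRep : A → Set
  IsRep x = D x × rep x ≡ x

  IsRep? : ∀ x → Dec (IsRep x)
  IsRep? x = D? x ×-dec (rep x ≟ x)

  rep-IsRep : ∀ {v} → D v → IsRep (rep v)
  rep-IsRep {v} Dv = D-∼ (rep-∼ v) Dv , rep-cong (rep-∼ v)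

  collectReps : List A → List (∃ IsRep)
  collectReps []       = []
  collectReps (w ∷ ws) with IsRep? w
  ... | yes w-rep = (w , w-rep) ∷ collectReps ws
  ... | no _      = collectReps ws

  count-collectReps : ∀ {x} → IsRep x → ∀ ws → count x (map proj₁ (collectReps ws)) ≡ count x ws
  count-collectReps x-rep []       = refl
  count-collectReps {x} x-rep (w ∷ ws) with IsRep? w
  ... | yes _     = trans (count-++ x [ w ] _) (trans (cong (count x [ w ] +_) (count-collectReps x-rep ws))
                                                       (sym (count-++ x [ w ] ws)))
  ... | no ¬w-rep = trans (count-collectReps x-rep ws)
                          (sym (count-there x w ws λ { refl → ¬w-rep x-rep }))

  count-collectReps-¬ : ∀ {x} → ¬ IsRep x → ∀ ws → count x (map proj₁ (collectReps ws)) ≡ 0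
  count-collectReps-¬ ¬x-rep []       = refl
  count-collectReps-¬ {x} ¬x-rep (w ∷ ws) with IsRep? w
  ... | yes w-rep = trans (count-there x w _ λ { refl → ¬x-rep w-rep }) (count-collectReps-¬ ¬x-rep ws)
  ... | no _      = count-collectReps-¬ ¬x-rep ws

  Reps : List (∃ IsRep)
  Reps = collectReps as

  orbit : List K → A → List A
  orbit ls x = map (λ k → act k x) ls

  count-orbit : ∀ ls → K.IsEnumeration ls → ∀ {x} → IsRep x → ∀ v → count v (orbit ls x) ≡ count (rep v) [ x ]
  count-orbit ls ls-enum {x} (Dx , rep-x) v with v ∼? x
  ... | yes (k , refl) = begin
    count (act k x) (orbit ls x)  ≡⟨ count-map-injective _≟_ _≟ₖ_ (λ l → act l x) (free Dx _ _) k ls ⟩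
    K.count k ls                  ≡⟨ ls-enum k ⟩
    1                             ≡⟨ count-here x [] ⟨
    count x [ x ]                 ≡⟨ cong (λ y → count y [ x ]) (trans (rep-cong (k , refl)) rep-x) ⟨
    count (rep (act k x)) [ x ]   ∎
  ... | no v≁x = trans (count-map-∉ v (λ l → act l x) ls (λ l v≡lx → v≁x (l , v≡lx)))
                       (sym (count-there (rep v) x [] λ rep-v≡x → v≁x (subst (v ∼_) rep-v≡x (∼-sym (rep-∼ v)))))

  orbits : List K → List A
  orbits ls = concatMap (orbit ls ∘ proj₁) Reps

  count-orbits : ∀ ls → K.IsEnumeration ls → ∀ v → count v (orbits ls) ≡ count (rep v) (map proj₁ Reps)
  count-orbits ls ls-enum v = go Reps
    where
    go : ∀ rs → count v (concatMap (orbit ls ∘ proj₁) rs) ≡ count (rep v) (map proj₁ rs)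
    go []                   = refl
    go ((x , x-rep) ∷ rs) = begin
      count v (orbit ls x ++ concatMap (orbit ls ∘ proj₁) rs)     ≡⟨ count-++ v (orbit ls x) _ ⟩
      count v (orbit ls x) + count v (concatMap (orbit ls ∘ proj₁) rs)
                                                                  ≡⟨ cong₂ _+_ (count-orbit ls ls-enum x-rep v) (go rs) ⟩
      count (rep v) [ x ] + count (rep v) (map proj₁ rs)          ≡⟨ count-++ (rep v) [ x ] _ ⟨
      count (rep v) (x ∷ map proj₁ rs)                            ∎

  orbits-cover : ∀ ls → K.IsEnumeration ls → ∀ {v} → D v → count v (orbits ls) ≡ 1
  orbits-cover ls ls-enum {v} Dv =
    trans (count-orbits ls ls-enum v) (trans (count-collectReps (rep-IsRep Dv) as) (as-enum (rep v)))

  orbits-avoid : ∀ ls → K.IsEnumeration ls → ∀ {v} → ¬ D v → count v (orbits ls) ≡ 0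
  orbits-avoid ls ls-enum {v} ¬Dv =
    trans (count-orbits ls ls-enum v) (count-collectReps-¬ (λ (D-rep-v , _) → ¬Dv (D-∼ (∼-sym (rep-∼ v)) D-rep-v)) as)

  length-orbits : ∀ ls → length (orbits ls) ≡ length Reps * length ls
  length-orbits ls = go Reps
    where
    go : ∀ rs → length (concatMap (orbit ls ∘ proj₁) rs) ≡ length rs * length ls
    go []       = refl
    go (r ∷ rs) = trans (length-++ (orbit ls (proj₁ r))) (cong₂ _+_ (length-map _ ls) (go rs))

  count-orbits-image : ∀ ls (f f⁻¹ : A → A) → (∀ k x → f (act k x) ≡ act k (f x)) →
                       (∀ x → f⁻¹ (f x) ≡ x) → (∀ y → f (f⁻¹ y) ≡ y) →
                       ∀ v → count v (concatMap (orbit ls ∘ f ∘ proj₁) Reps) ≡ count (f⁻¹ v) (orbits ls)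
  count-orbits-image ls f f⁻¹ f-equivariant f⁻¹-f f-f⁻¹ v = begin
    count v (concatMap (orbit ls ∘ f ∘ proj₁) Reps)   ≡⟨ cong (count v) images ⟩
    count v (map f (orbits ls))                       ≡⟨ cong (λ y → count y (map f (orbits ls))) (f-f⁻¹ v) ⟨
    count (f (f⁻¹ v)) (map f (orbits ls))             ≡⟨ count-map-injective _≟_ _≟_ f f-injective (f⁻¹ v) (orbits ls) ⟩
    count (f⁻¹ v) (orbits ls)                         ∎
    where
    f-injective : ∀ {x y} → f x ≡ f y → x ≡ y
    f-injective {x} {y} fx≡fy = trans (sym (f⁻¹-f x)) (trans (cong f⁻¹ fx≡fy) (f⁻¹-f y))
    images : concatMap (orbit ls ∘ f ∘ proj₁) Reps ≡ map f (orbits ls)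
    images = trans (cong List.concat (map-cong (λ r → trans (map-cong (λ k → sym (f-equivariant k (proj₁ r))) ls)
                                                           (map-∘ ls)) Reps))
                   (sym (map-concatMap f (orbit ls ∘ proj₁) Reps))

not-x-xor-x : ∀ x → not x xor x ≡ true
not-x-xor-x x = trans (sym (not-distribˡ-xor x x)) (cong not (xor-same x))

x-xor-not-x : ∀ x → x xor not x ≡ true
x-xor-not-x x = trans (sym (not-distribʳ-xor x x)) (cong not (xor-same x))

applyIf : ∀ {A : Set} → Bool → (A → A) → A → A
applyIf b f = if b then f else id

applyIf-xor : ∀ {A : Set} {f : A → A} → (∀ x → f (f x) ≡ x) →
              ∀ b c x → applyIf b f (applyIf c f x) ≡ applyIf (b xor c) f x
applyIf-xor f-involutive true  true  x = f-involutive x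
applyIf-xor f-involutive true  false x = refl
applyIf-xor f-involutive false c     x = refl

applyIf-comm : ∀ {A : Set} {f g : A → A} → (∀ x → f (g x) ≡ g (f x)) →
               ∀ b c x → applyIf b f (applyIf c g x) ≡ applyIf c g (applyIf b f x)
applyIf-comm f-g true  true  x = f-g x
applyIf-comm f-g true  false x = refl
applyIf-comm f-g false c     x = refl

-- The group of order four generated by an involution σ and a commuting map τ with τ² = σ^c:
-- (s , r) acts as σ^s τ^r.  For c = true it is cyclic, generated by τ; for c = false it is a Klein group.
module FourGroup {A : Set} (σ τ : A → A) (c : Bool)
                 (σ-involutive : ∀ x → σ (σ x) ≡ x) (σ-τ : ∀ x → σ (τ x) ≡ τ (σ x))
                 (τ-τ : ∀ x → τ (τ x) ≡ applyIf c σ x) where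

  K : Set
  K = Bool × Bool

  _≟_ : DecidableEquality K
  _≟_ = ≡-dec Bool._≟_ Bool._≟_

  elements : List K
  elements = (false , false) ∷ (false , true) ∷ (true , false) ∷ (true , true) ∷ []

  enumeration-by-cases : ∀ ks → let open Count _≟_ in
                         count (false , false) ks ≡ 1 → count (false , true) ks ≡ 1 →
                         count (true , false) ks ≡ 1 → count (true , true) ks ≡ 1 → IsEnumeration ks
  enumeration-by-cases ks c₀₀ c₀₁ c₁₀ c₁₁ (false , false) = c₀₀
  enumeration-by-cases ks c₀₀ c₀₁ c₁₀ c₁₁ (false , true)  = c₀₁
  enumeration-by-cases ks c₀₀ c₀₁ c₁₀ c₁₁ (true  , false) = c₁₀
  enumeration-by-cases ks c₀₀ c₀₁ c₁₀ c₁₁ (true  , true)  = c₁₁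

  elements-enumeration : Count.IsEnumeration _≟_ elements
  elements-enumeration = enumeration-by-cases elements refl refl refl refl

  act : K → A → A
  act (s , r) x = applyIf s σ (applyIf r τ x)

  infixl 7 _·_
  infix 8 _⁻¹

  _·_ : K → K → K
  (s , r) · (s′ , r′) = s xor s′ xor r ∧ r′ ∧ c , r xor r′

  _⁻¹ : K → K
  (s , r) ⁻¹ = s xor r ∧ c , r

  τ^-τ^ : ∀ r r′ x → applyIf r τ (applyIf r′ τ x) ≡ applyIf (r ∧ r′ ∧ c) σ (applyIf (r xor r′) τ x)
  τ^-τ^ true  true  x = τ-τ x
  τ^-τ^ true  false x = refl
  τ^-τ^ false r′    x = refl

  act-· : ∀ k l x → act k (act l x) ≡ act (k · l) x
  act-· (s , r) (s′ , r′) x = begin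
    applyIf s σ (applyIf r τ (applyIf s′ σ (applyIf r′ τ x)))
      ≡⟨ cong (applyIf s σ) (applyIf-comm (λ y → sym (σ-τ y)) r s′ _) ⟩
    applyIf s σ (applyIf s′ σ (applyIf r τ (applyIf r′ τ x)))
      ≡⟨ cong (applyIf s σ ∘′ applyIf s′ σ) (τ^-τ^ r r′ x) ⟩
    applyIf s σ (applyIf s′ σ (applyIf (r ∧ r′ ∧ c) σ (applyIf (r xor r′) τ x)))
      ≡⟨ cong (applyIf s σ) (applyIf-xor σ-involutive s′ _ _) ⟩
    applyIf s σ (applyIf (s′ xor r ∧ r′ ∧ c) σ (applyIf (r xor r′) τ x))
      ≡⟨ applyIf-xor σ-involutive s _ _ ⟩
    act ((s , r) · (s′ , r′)) x
      ∎

  ⁻¹-inverse : ∀ k → k ⁻¹ · k ≡ (false , false)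
  ⁻¹-inverse (false , false) = refl
  ⁻¹-inverse (false , true)  = cong (_, false) (xor-same c)
  ⁻¹-inverse (true  , false) = refl
  ⁻¹-inverse (true  , true)  = cong (_, false) (xor-same (not c))

  act-⁻¹ : ∀ k x → act (k ⁻¹) (act k x) ≡ x
  act-⁻¹ k x = trans (act-· (k ⁻¹) k x) (cong (λ l → act l x) (⁻¹-inverse k))

  ⁻¹-cancel : ∀ k l → l ⁻¹ · k ≡ (false , false) → k ≡ l
  ⁻¹-cancel (false , false) (false , false) _  = refl
  ⁻¹-cancel (true  , false) (true  , false) _  = refl
  ⁻¹-cancel (false , true)  (false , true)  _  = refl
  ⁻¹-cancel (true  , true)  (true  , true)  _  = refl
  ⁻¹-cancel (false , true)  (true  , true)  eq = contradiction (trans (sym (not-x-xor-x c)) (cong proj₁ eq)) λ ()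
  ⁻¹-cancel (true  , true)  (false , true)  eq = contradiction (trans (sym (x-xor-not-x c)) (cong proj₁ eq)) λ ()
  ⁻¹-cancel (false , false) (true  , false) ()
  ⁻¹-cancel (true  , false) (false , false) ()
  ⁻¹-cancel (false , false) (_     , true)  ()
  ⁻¹-cancel (true  , false) (_     , true)  ()
  ⁻¹-cancel (_     , true)  (_     , false) ()

  act-preserves : ∀ {P : A → Set} → (∀ {x} → P x → P (σ x)) → (∀ {x} → P x → P (τ x)) →
                  ∀ k {x} → P x → P (act k x)
  act-preserves {P} P-σ P-τ (s , r) Px = applyIf-preserves P-σ s (applyIf-preserves P-τ r Px)
    where
    applyIf-preserves : ∀ {f : A → A} → (∀ {x} → P x → P (f x)) → ∀ b {x} → P x → P (applyIf b f x)
    applyIf-preserves P-f true  Px = P-f Px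
    applyIf-preserves P-f false Px = Px

  act-preserves-¬ : ∀ {P : A → Set} → (∀ {x} → P x → P (σ x)) → (∀ {x} → P x → P (τ x)) →
                    ∀ k {x} → ¬ P x → ¬ P (act k x)
  act-preserves-¬ {P} P-σ P-τ k {x} ¬Px P-kx = ¬Px (subst P (act-⁻¹ k x) (act-preserves {P} P-σ P-τ (k ⁻¹) {act k x} P-kx))

  freeAction : ∀ {P : A → Set} → (∀ {x} → P x → P (σ x)) → (∀ {x} → P x → P (τ x)) →
               (∀ {x} → ¬ P x → σ x ≢ x × τ x ≢ x × σ (τ x) ≢ x) → FreeAction K (λ x → ¬ P x)
  freeAction {P} P-σ P-τ moves = record
    { act = act ; ε = false , false ; _·_ = _·_ ; _⁻¹ = _⁻¹
    ; act-ε = λ _ → refl ; act-· = act-· ; act-⁻¹ = act-⁻¹ ; ⁻¹-cancel = ⁻¹-cancel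
    ; act-D = act-preserves-¬ P-σ P-τ ; fixed-point-free = fixed-point-free }
    where
    fixed-point-free : ∀ k {x} → ¬ P x → act k x ≡ x → k ≡ (false , false)
    fixed-point-free (false , false)     ¬Px _     = refl
    fixed-point-free (true  , false) {x} ¬Px σx≡x  = contradiction σx≡x (proj₁ (moves {x} ¬Px))
    fixed-point-free (false , true)  {x} ¬Px τx≡x  = contradiction τx≡x (proj₁ (proj₂ (moves {x} ¬Px)))
    fixed-point-free (true  , true)  {x} ¬Px στx≡x = contradiction στx≡x (proj₂ (proj₂ (moves {x} ¬Px)))

module Residues (m : ℕ) .{{_ : NonZero m}} where

  infix  8 -_
  infixl 7 _*_
  infixl 6 _+_

  ⟦_⟧ : ℕ → Fin m
  ⟦ n ⟧ = n mod m

  _+_ : Fin m → Fin m → Fin m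
  _+_ = _+ₘ_

  -_ : Fin m → Fin m
  -_ = -ₘ_

  0# : Fin m
  0# = 0ₘ

  _*_ : Fin m → Fin m → Fin m
  a * b = ⟦ toℕ a ℕ.* toℕ b ⟧

  1# : Fin m
  1# = ⟦ 1 ⟧

  toℕ⟦x⟧≡x%m : ∀ x → toℕ ⟦ x ⟧ ≡ x % m
  toℕ⟦x⟧≡x%m x = toℕ-fromℕ< _

  x%m≡y%m⇒⟦x⟧≡⟦y⟧ : ∀ {x y} → x % m ≡ y % m → ⟦ x ⟧ ≡ ⟦ y ⟧
  x%m≡y%m⇒⟦x⟧≡⟦y⟧ {x} {y} x≡y = toℕ-injective (trans (toℕ⟦x⟧≡x%m x) (trans x≡y (sym (toℕ⟦x⟧≡x%m y))))

  ⟦toℕ⟧ : ∀ a → ⟦ toℕ a ⟧ ≡ a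
  ⟦toℕ⟧ a = toℕ-injective (trans (toℕ⟦x⟧≡x%m (toℕ a)) (m<n⇒m%n≡m (toℕ<n a)))

  ⟦toℕ⟦x⟧+y⟧≡⟦x+y⟧ : ∀ x y → ⟦ toℕ ⟦ x ⟧ ℕ.+ y ⟧ ≡ ⟦ x ℕ.+ y ⟧
  ⟦toℕ⟦x⟧+y⟧≡⟦x+y⟧ x y = x%m≡y%m⇒⟦x⟧≡⟦y⟧ (begin
    (toℕ ⟦ x ⟧ ℕ.+ y) % m          ≡⟨ cong (λ u → (u ℕ.+ y) % m) (toℕ⟦x⟧≡x%m x) ⟩
    (x % m ℕ.+ y) % m              ≡⟨ %-distribˡ-+ (x % m) y m ⟩
    (x % m % m ℕ.+ y % m) % m      ≡⟨ cong (λ u → (u ℕ.+ y % m) % m) (m%n%n≡m%n x m) ⟩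
    (x % m ℕ.+ y % m) % m          ≡⟨ %-distribˡ-+ x y m ⟨
    (x ℕ.+ y) % m                  ∎)

  ⟦x+toℕ⟦y⟧⟧≡⟦x+y⟧ : ∀ x y → ⟦ x ℕ.+ toℕ ⟦ y ⟧ ⟧ ≡ ⟦ x ℕ.+ y ⟧
  ⟦x+toℕ⟦y⟧⟧≡⟦x+y⟧ x y = trans (cong ⟦_⟧ (ℕ.+-comm x _)) (trans (⟦toℕ⟦x⟧+y⟧≡⟦x+y⟧ y x) (cong ⟦_⟧ (ℕ.+-comm y x)))

  ⟦toℕ⟦x⟧*y⟧≡⟦x*y⟧ : ∀ x y → ⟦ toℕ ⟦ x ⟧ ℕ.* y ⟧ ≡ ⟦ x ℕ.* y ⟧
  ⟦toℕ⟦x⟧*y⟧≡⟦x*y⟧ x y = x%m≡y%m⇒⟦x⟧≡⟦y⟧ (begin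
    (toℕ ⟦ x ⟧ ℕ.* y) % m          ≡⟨ cong (λ u → (u ℕ.* y) % m) (toℕ⟦x⟧≡x%m x) ⟩
    (x % m ℕ.* y) % m              ≡⟨ %-distribˡ-* (x % m) y m ⟩
    (x % m % m ℕ.* (y % m)) % m    ≡⟨ cong (λ u → (u ℕ.* (y % m)) % m) (m%n%n≡m%n x m) ⟩
    (x % m ℕ.* (y % m)) % m        ≡⟨ %-distribˡ-* x y m ⟨
    (x ℕ.* y) % m                  ∎)

  ⟦x*toℕ⟦y⟧⟧≡⟦x*y⟧ : ∀ x y → ⟦ x ℕ.* toℕ ⟦ y ⟧ ⟧ ≡ ⟦ x ℕ.* y ⟧
  ⟦x*toℕ⟦y⟧⟧≡⟦x*y⟧ x y = trans (cong ⟦_⟧ (ℕ.*-comm x _)) (trans (⟦toℕ⟦x⟧*y⟧≡⟦x*y⟧ y x) (cong ⟦_⟧ (ℕ.*-comm y x)))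

  ⟦x⟧+⟦y⟧≡⟦x+y⟧ : ∀ x y → ⟦ x ⟧ + ⟦ y ⟧ ≡ ⟦ x ℕ.+ y ⟧
  ⟦x⟧+⟦y⟧≡⟦x+y⟧ x y = trans (⟦toℕ⟦x⟧+y⟧≡⟦x+y⟧ x _) (⟦x+toℕ⟦y⟧⟧≡⟦x+y⟧ x y)

  ⟦x⟧*⟦y⟧≡⟦x*y⟧ : ∀ x y → ⟦ x ⟧ * ⟦ y ⟧ ≡ ⟦ x ℕ.* y ⟧
  ⟦x⟧*⟦y⟧≡⟦x*y⟧ x y = trans (⟦toℕ⟦x⟧*y⟧≡⟦x*y⟧ x _) (⟦x*toℕ⟦y⟧⟧≡⟦x*y⟧ x y)

  +-isAbelianGroup : IsAbelianGroup _≡_ _+_ 0# -_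
  +-isAbelianGroup = record
    { isGroup = record
      { isMonoid = record
        { isSemigroup = record
          { isMagma = record { isEquivalence = isEquivalence ; ∙-cong = cong₂ _+_ }
          ; assoc   = λ a b c → trans (⟦toℕ⟦x⟧+y⟧≡⟦x+y⟧ _ _)
                                (trans (cong ⟦_⟧ (ℕ.+-assoc (toℕ a) _ _)) (sym (⟦x+toℕ⟦y⟧⟧≡⟦x+y⟧ (toℕ a) _))) }
        ; identity = (λ a → trans (⟦toℕ⟦x⟧+y⟧≡⟦x+y⟧ 0 (toℕ a)) (⟦toℕ⟧ a))
                   , (λ a → trans (⟦x+toℕ⟦y⟧⟧≡⟦x+y⟧ (toℕ a) 0) (trans (cong ⟦_⟧ (ℕ.+-comm (toℕ a) 0)) (⟦toℕ⟧ a))) }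
      ; inverse = (λ a → trans (⟦toℕ⟦x⟧+y⟧≡⟦x+y⟧ (m ℕ.∸ toℕ a) (toℕ a)) (m∸toℕ+toℕ a))
                , (λ a → trans (⟦x+toℕ⟦y⟧⟧≡⟦x+y⟧ (toℕ a) (m ℕ.∸ toℕ a))
                               (trans (cong ⟦_⟧ (ℕ.+-comm (toℕ a) _)) (m∸toℕ+toℕ a)))
      ; ⁻¹-cong = cong -_ }
    ; comm = λ a b → cong ⟦_⟧ (ℕ.+-comm (toℕ a) (toℕ b)) }
    where
    m∸toℕ+toℕ : ∀ a → ⟦ m ℕ.∸ toℕ a ℕ.+ toℕ a ⟧ ≡ 0#
    m∸toℕ+toℕ a = trans (cong ⟦_⟧ (ℕ.m∸n+n≡m (ℕ.<⇒≤ (toℕ<n a))))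
                        (x%m≡y%m⇒⟦x⟧≡⟦y⟧ (trans (n%n≡0 m) (sym (m<n⇒m%n≡m (ℕ.>-nonZero⁻¹ m)))))

  +-*-isCommutativeRing : IsCommutativeRing _≡_ _+_ _*_ -_ 0# 1#
  +-*-isCommutativeRing = record
    { isRing = record
      { +-isAbelianGroup = +-isAbelianGroup
      ; *-cong           = cong₂ _*_
      ; *-assoc          = λ a b c → trans (⟦toℕ⟦x⟧*y⟧≡⟦x*y⟧ _ _)
                                     (trans (cong ⟦_⟧ (ℕ.*-assoc (toℕ a) _ _)) (sym (⟦x*toℕ⟦y⟧⟧≡⟦x*y⟧ (toℕ a) _)))
      ; *-identity       = (λ a → trans (⟦toℕ⟦x⟧*y⟧≡⟦x*y⟧ 1 (toℕ a)) (trans (cong ⟦_⟧ (ℕ.*-identityˡ (toℕ a))) (⟦toℕ⟧ a)))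
                         , (λ a → trans (⟦x*toℕ⟦y⟧⟧≡⟦x*y⟧ (toℕ a) 1) (trans (cong ⟦_⟧ (ℕ.*-identityʳ (toℕ a))) (⟦toℕ⟧ a)))
      ; distrib          = distribˡ , λ a b c → trans (*-comm′ (b + c) a)
                                               (trans (distribˡ a b c) (cong₂ _+_ (*-comm′ a b) (*-comm′ a c))) }
    ; *-comm = *-comm′ }
    where
    *-comm′ : ∀ a b → a * b ≡ b * a
    *-comm′ a b = cong ⟦_⟧ (ℕ.*-comm (toℕ a) (toℕ b))
    distribˡ : ∀ a b c → a * (b + c) ≡ (a * b) + (a * c)
    distribˡ a b c = begin
      ⟦ toℕ a ℕ.* toℕ ⟦ toℕ b ℕ.+ toℕ c ⟧ ⟧                    ≡⟨ ⟦x*toℕ⟦y⟧⟧≡⟦x*y⟧ (toℕ a) _ ⟩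
      ⟦ toℕ a ℕ.* (toℕ b ℕ.+ toℕ c) ⟧                          ≡⟨ cong ⟦_⟧ (ℕ.*-distribˡ-+ (toℕ a) (toℕ b) _) ⟩
      ⟦ toℕ a ℕ.* toℕ b ℕ.+ toℕ a ℕ.* toℕ c ⟧                  ≡⟨ ⟦x+toℕ⟦y⟧⟧≡⟦x+y⟧ _ _ ⟨
      ⟦ toℕ a ℕ.* toℕ b ℕ.+ toℕ (a * c) ⟧                      ≡⟨ ⟦toℕ⟦x⟧+y⟧≡⟦x+y⟧ _ _ ⟨
      (a * b) + (a * c)                                       ∎

  commutativeRing : CommutativeRing _ _
  commutativeRing = record { isCommutativeRing = +-*-isCommutativeRing }

-- Gaussian modules

module _ {A : Set} {_+_ : A → A → A} {0# : A} { -_ : A → A} where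

  isAbelianGroupʳ : Associative _≡_ _+_ → Commutative _≡_ _+_ → RightIdentity _≡_ 0# _+_ →
                    RightInverse _≡_ 0# -_ _+_ → IsAbelianGroup _≡_ _+_ 0# -_
  isAbelianGroupʳ assoc comm identityʳ inverseʳ = record
    { isGroup = record
      { isMonoid = record
        { isSemigroup = record { isMagma = record { isEquivalence = isEquivalence ; ∙-cong = cong₂ _+_ } ; assoc = assoc }
        ; identity    = (λ x → trans (comm 0# x) (identityʳ x)) , identityʳ }
      ; inverse = (λ x → trans (comm (- x) x) (inverseʳ x)) , inverseʳ
      ; ⁻¹-cong = cong -_ }
    ; comm = comm }

  -- An abelian group in which doubling is invertible, as in every finite abelian group of odd order.
  record IsOddAbelianGroup : Set where
    field
      isAbelianGroup : IsAbelianGroup _≡_ _+_ 0# -_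
      half           : A → A
      half-double    : ∀ x → half (x + x) ≡ x
      double-half    : ∀ x → half x + half x ≡ x

    abelianGroup : AbelianGroup _ _
    abelianGroup = record { isAbelianGroup = isAbelianGroup }

    open IsAbelianGroup isAbelianGroup public using (assoc; comm; identityˡ; identityʳ; inverseˡ; inverseʳ)
    open AbelianGroupProperties abelianGroup public
      using (∙-cancelˡ; inverseˡ-unique; inverseʳ-unique; x∙y⁻¹≈ε⇒x≈y; ⁻¹-involutive; ⁻¹-∙-comm; ε⁻¹≈ε)
    open CommutativeSemigroupProperties (AbelianGroup.commutativeSemigroup abelianGroup) public using (interchange)

    half-0# : half 0# ≡ 0#
    half-0# = trans (cong half (sym (identityʳ 0#))) (half-double 0#)

    double≡0#⇒≡0# : ∀ {x} → x + x ≡ 0# → x ≡ 0#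
    double≡0#⇒≡0# {x} 2x≡0 = trans (sym (half-double x)) (trans (cong half 2x≡0) half-0#)

    ≡-⇒≡0# : ∀ {x} → x ≡ - x → x ≡ 0#
    ≡-⇒≡0# {x} x≡-x = double≡0#⇒≡0# (trans (cong (x +_) x≡-x) (inverseʳ x))

    half-+ : ∀ x y → half (x + y) ≡ half x + half y
    half-+ x y = begin
      half (x + y)                                    ≡⟨ cong half (cong₂ _+_ (double-half x) (double-half y)) ⟨
      half ((half x + half x) + (half y + half y))    ≡⟨ cong half (interchange _ _ _ _) ⟩
      half ((half x + half y) + (half x + half y))    ≡⟨ half-double _ ⟩
      half x + half y                                 ∎

    half-homomorphism : ∀ (f : A → A) → (∀ x y → f (x + y) ≡ f x + f y) → ∀ x → half (f x) ≡ f (half x)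
    half-homomorphism f f-+ x = begin
      half (f x)                         ≡⟨ cong (half ∘ f) (double-half x) ⟨
      half (f (half x + half x))         ≡⟨ cong half (f-+ _ _) ⟩
      half (f (half x) + f (half x))     ≡⟨ half-double _ ⟩
      f (half x)                         ∎

  -- A module over ℤ[i, 1/2]: the map i plays the role of multiplication by a square root of -1.
  record IsGaussianModule : Set where
    field
      isOddAbelianGroup : IsOddAbelianGroup
      i                 : A → A
      i-+               : ∀ x y → i (x + y) ≡ i x + i y
      i-i               : ∀ x → i (i x) ≡ - x

    open IsOddAbelianGroup isOddAbelianGroup public

    i-0# : i 0# ≡ 0#
    i-0# = ∙-cancelˡ (i 0#) _ _ (trans (sym (i-+ 0# 0#)) (trans (cong i (identityʳ 0#)) (sym (identityʳ (i 0#)))))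

    i-‿ : ∀ x → i (- x) ≡ - i x
    i-‿ x = inverseʳ-unique (i x) (i (- x)) (trans (sym (i-+ x (- x))) (trans (cong i (inverseʳ x)) i-0#))

    i≢id : ∀ {x} → x ≢ 0# → i x ≢ x
    i≢id {x} x≢0 ix≡x = x≢0 (≡-⇒≡0# (sym (begin
      - x       ≡⟨ i-i x ⟨
      i (i x)   ≡⟨ cong i ix≡x ⟩
      i x       ≡⟨ ix≡x ⟩
      x         ∎)))

    -i≢id : ∀ {x} → x ≢ 0# → - i x ≢ x
    -i≢id {x} x≢0 -ix≡x = x≢0 (≡-⇒≡0# (sym (begin
      - x         ≡⟨ i-i x ⟨
      i (i x)     ≡⟨ cong i ix≡-x ⟩
      i (- x)     ≡⟨ i-‿ x ⟩
      - i x       ≡⟨ -ix≡x ⟩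
      x           ∎)))
      where
      ix≡-x : i x ≡ - x
      ix≡-x = trans (sym (⁻¹-involutive (i x))) (cong -_ -ix≡x)

    -- The units ±1, ±i of ℤ[i], acting as σ^s τ^r with σ = -_ and τ = i.
    module Units = FourGroup -_ i true ⁻¹-involutive (λ x → sym (i-‿ x)) i-i

    units : FreeAction Units.K (_≢ 0#)
    units = Units.freeAction (λ x≡0 → trans (cong -_ x≡0) ε⁻¹≈ε) (λ x≡0 → trans (cong i x≡0) i-0#)
                             (λ x≢0 → (λ -x≡x → x≢0 (≡-⇒≡0# (sym -x≡x))) , i≢id x≢0 , -i≢id x≢0)

    units-equivariant : ∀ (f : A → A) → (∀ x → f (- x) ≡ - f x) → (∀ x → f (i x) ≡ i (f x)) →
                        ∀ k x → f (Units.act k x) ≡ Units.act k (f x)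
    units-equivariant f f-‿ f-i (false , false) x = refl
    units-equivariant f f-‿ f-i (false , true)  x = f-i x
    units-equivariant f f-‿ f-i (true  , false) x = f-‿ x
    units-equivariant f f-‿ f-i (true  , true)  x = trans (f-‿ (i x)) (cong -_ (f-i x))

module _ {A : Set} {_+_ _*_ : A → A → A} { -_ : A → A} {0# 1# : A}
         (R : IsCommutativeRing _≡_ _+_ _*_ -_ 0# 1#) (½ : A) (½+½≡1 : ½ + ½ ≡ 1#) where

  open IsCommutativeRing R using (+-isAbelianGroup; distribˡ; distribʳ; *-identityˡ; *-assoc)

  private
    commutativeRing : CommutativeRing _ _
    commutativeRing = record { isCommutativeRing = R }

  open RingProperties (CommutativeRing.ring commutativeRing) using (-1*x≈-x)

  ring-isOddAbelianGroup : IsOddAbelianGroup {_+_ = _+_} {0#} { -_ }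
  ring-isOddAbelianGroup = record
    { isAbelianGroup = +-isAbelianGroup
    ; half           = ½ *_
    ; half-double    = λ x → trans (distribˡ ½ x x) (double-half x)
    ; double-half    = double-half }
    where
    double-half : ∀ x → (½ * x) + (½ * x) ≡ x
    double-half x = trans (sym (distribʳ x ½ ½)) (trans (cong (_* x) ½+½≡1) (*-identityˡ x))

  ring-isGaussianModule : ∀ ι → ι * ι ≡ - 1# → IsGaussianModule {_+_ = _+_} {0#} { -_ }
  ring-isGaussianModule ι ι²≡-1 = record
    { isOddAbelianGroup = ring-isOddAbelianGroup
    ; i                 = ι *_
    ; i-+               = distribˡ ι
    ; i-i               = λ x → trans (sym (*-assoc ι ι x)) (trans (cong (_* x) ι²≡-1) (-1*x≈-x x)) }

module _ {A : Set} {_+_ : A → A → A} {0# : A} { -_ : A → A} where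

  vec-isOddAbelianGroup : IsOddAbelianGroup {_+_ = _+_} {0#} { -_ } →
                          ∀ n → IsOddAbelianGroup {_+_ = Vec.zipWith {n = n} _+_} {Vec.replicate n 0#} {Vec.map -_}
  vec-isOddAbelianGroup G n = record
    { isAbelianGroup = isAbelianGroupʳ (Vec.zipWith-assoc assoc) (Vec.zipWith-comm comm)
                                       (Vec.zipWith-identityʳ identityʳ) (Vec.zipWith-inverseʳ inverseʳ)
    ; half           = Vec.map half
    ; half-double    = half-double′
    ; double-half    = double-half′ }
    where
    open IsOddAbelianGroup G
    half-double′ : ∀ {n} (xs : Vec A n) → Vec.map half (Vec.zipWith _+_ xs xs) ≡ xs
    half-double′ []       = refl
    half-double′ (x ∷ xs) = cong₂ _∷_ (half-double x) (half-double′ xs)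
    double-half′ : ∀ {n} (xs : Vec A n) → Vec.zipWith _+_ (Vec.map half xs) (Vec.map half xs) ≡ xs
    double-half′ []       = refl
    double-half′ (x ∷ xs) = cong₂ _∷_ (double-half x) (double-half′ xs)

  vec-isGaussianModule : IsGaussianModule {_+_ = _+_} {0#} { -_ } →
                         ∀ n → IsGaussianModule {_+_ = Vec.zipWith {n = n} _+_} {Vec.replicate n 0#} {Vec.map -_}
  vec-isGaussianModule M n = record
    { isOddAbelianGroup = vec-isOddAbelianGroup isOddAbelianGroup n
    ; i                 = Vec.map i
    ; i-+               = i-+′
    ; i-i               = i-i′ }
    where
    open IsGaussianModule M
    i-+′ : ∀ {n} (xs ys : Vec A n) → Vec.map i (Vec.zipWith _+_ xs ys) ≡ Vec.zipWith _+_ (Vec.map i xs) (Vec.map i ys)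
    i-+′ []       []       = refl
    i-+′ (x ∷ xs) (y ∷ ys) = cong₂ _∷_ (i-+ x y) (i-+′ xs ys)
    i-i′ : ∀ {n} (xs : Vec A n) → Vec.map i (Vec.map i xs) ≡ Vec.map -_ xs
    i-i′ []       = refl
    i-i′ (x ∷ xs) = cong₂ _∷_ (i-i x) (i-i′ xs)

  rotate : ∀ j → Vec A (j ℕ.* 2) → Vec A (j ℕ.* 2)
  rotate zero    []           = []
  rotate (suc j) (x ∷ y ∷ xs) = - y ∷ x ∷ rotate j xs

  rotation-isGaussianModule : IsOddAbelianGroup {_+_ = _+_} {0#} { -_ } →
                              ∀ j → IsGaussianModule {_+_ = Vec.zipWith {n = j ℕ.* 2} _+_}
                                                     {Vec.replicate (j ℕ.* 2) 0#} {Vec.map -_}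
  rotation-isGaussianModule G j = record
    { isOddAbelianGroup = vec-isOddAbelianGroup G (j ℕ.* 2)
    ; i                 = rotate j
    ; i-+               = rotate-+ j
    ; i-i               = rotate-rotate j }
    where
    open IsOddAbelianGroup G
    rotate-+ : ∀ j (xs ys : Vec A (j ℕ.* 2)) → rotate j (Vec.zipWith _+_ xs ys) ≡ Vec.zipWith _+_ (rotate j xs) (rotate j ys)
    rotate-+ zero    []           []             = refl
    rotate-+ (suc j) (x ∷ y ∷ xs) (x′ ∷ y′ ∷ ys) =
      cong₂ _∷_ (sym (⁻¹-∙-comm y y′)) (cong (x + x′ ∷_) (rotate-+ j xs ys))
    rotate-rotate : ∀ j (xs : Vec A (j ℕ.* 2)) → rotate j (rotate j xs) ≡ Vec.map -_ xs
    rotate-rotate zero    []           = refl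
    rotate-rotate (suc j) (x ∷ y ∷ xs) = cong (λ zs → - x ∷ - y ∷ zs) (rotate-rotate j xs)

module _ {A B : Set} {_+₁_ : A → A → A} {0₁ : A} { -₁_ : A → A} {_+₂_ : B → B → B} {0₂ : B} { -₂_ : B → B} where

  ×-isGaussianModule : IsGaussianModule {_+_ = _+₁_} {0₁} { -₁_ } → IsGaussianModule {_+_ = _+₂_} {0₂} { -₂_ } →
                       IsGaussianModule {_+_ = λ (x , y) (x′ , y′) → x +₁ x′ , y +₂ y′}
                                        {0₁ , 0₂} {λ (x , y) → -₁ x , -₂ y}
  ×-isGaussianModule M N = record
    { isOddAbelianGroup = record
      { isAbelianGroup = isAbelianGroupʳ (λ (x , y) (x′ , y′) (x″ , y″) →
                                              cong₂ _,_ (M.assoc x x′ x″) (N.assoc y y′ y″))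
                                         (λ (x , y) (x′ , y′) → cong₂ _,_ (M.comm x x′) (N.comm y y′))
                                         (λ (x , y) → cong₂ _,_ (M.identityʳ x) (N.identityʳ y))
                                         (λ (x , y) → cong₂ _,_ (M.inverseʳ x) (N.inverseʳ y))
      ; half           = λ (x , y) → M.half x , N.half y
      ; half-double    = λ (x , y) → cong₂ _,_ (M.half-double x) (N.half-double y)
      ; double-half    = λ (x , y) → cong₂ _,_ (M.double-half x) (N.double-half y) }
    ; i   = λ (x , y) → M.i x , N.i y
    ; i-+ = λ (x , y) (x′ , y′) → cong₂ _,_ (M.i-+ x x′) (N.i-+ y y′)
    ; i-i = λ (x , y) → cong₂ _,_ (M.i-i x) (N.i-i y) }
    where
    module M = IsGaussianModule M
    module N = IsGaussianModule N

⊤-isGaussianModule : IsGaussianModule {_+_ = λ _ _ → tt} {tt} {λ _ → tt}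
⊤-isGaussianModule = record
  { isOddAbelianGroup = record
    { isAbelianGroup = isAbelianGroupʳ (λ _ _ _ → refl) (λ _ _ → refl) (λ _ → refl) (λ _ → refl)
    ; half = λ _ → tt ; half-double = λ _ → refl ; double-half = λ _ → refl }
  ; i = λ _ → tt ; i-+ = λ _ _ → refl ; i-i = λ _ → refl }

-- Residues modulo odd numbers and primes; a square root of -1

module OddResidues (m : ℕ) .{{_ : NonZero m}} (j : ℕ) (m≡2j+1 : m ≡ suc (j ℕ.* 2)) where
  open Residues m

  ½ : Fin m
  ½ = ⟦ suc j ⟧

  ½+½≡1 : ½ + ½ ≡ 1#
  ½+½≡1 = begin
    ⟦ suc j ⟧ + ⟦ suc j ⟧      ≡⟨ ⟦x⟧+⟦y⟧≡⟦x+y⟧ (suc j) (suc j) ⟩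
    ⟦ suc j ℕ.+ suc j ⟧        ≡⟨ cong ⟦_⟧ (+-*-Solver.solve 1 (λ j → (con 1 :+ j) :+ (con 1 :+ j)
                                                                  := con 1 :+ (con 1 :+ j :* con 2)) refl j) ⟩
    ⟦ 1 ℕ.+ suc (j ℕ.* 2) ⟧    ≡⟨ cong (λ n → ⟦ 1 ℕ.+ n ⟧) m≡2j+1 ⟨
    ⟦ 1 ℕ.+ m ⟧                ≡⟨ x%m≡y%m⇒⟦x⟧≡⟦y⟧ ([m+n]%n≡m%n 1 m) ⟩
    1#                         ∎
    where open +-*-Solver using (_:+_; _:*_; _:=_; con)

  isOddAbelianGroup : IsOddAbelianGroup {_+_ = _+_} {0#} { -_ }
  isOddAbelianGroup = ring-isOddAbelianGroup +-*-isCommutativeRing ½ ½+½≡1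

module PrimeResidues (p : ℕ) (p-prime : Prime p) where

  private instance
    p≢0 : NonZero p
    p≢0 = prime⇒nonZero p-prime

  open Residues p public
  open CommutativeRing commutativeRing public
    using (+-comm; -‿inverseʳ; *-assoc; *-comm; *-identityˡ; *-identityʳ; distribˡ; zeroˡ)
  open RingProperties (CommutativeRing.ring commutativeRing) public
    using (-‿distribˡ-*; -‿distribʳ-*; -‿involutive; +-inverseʳ-unique; -0#≈0#; [y-z]x≈yx-zx)

  1<p : 1 < p
  1<p = ℕ.nonTrivial⇒n>1 p {{prime⇒nonTrivial p-prime}}

  toℕ-0# : toℕ 0# ≡ 0
  toℕ-0# = trans (toℕ⟦x⟧≡x%m 0) (m<n⇒m%n≡m (ℕ.>-nonZero⁻¹ p))

  1#≢0# : 1# ≢ 0#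
  1#≢0# 1≡0 with trans (sym (trans (toℕ⟦x⟧≡x%m 1) (m<n⇒m%n≡m 1<p))) (trans (cong toℕ 1≡0) toℕ-0#)
  ... | ()

  divisible⇒≡0# : ∀ a → p ∣ toℕ a → a ≡ 0#
  divisible⇒≡0# a p∣a = toℕ-injective (trans (small (toℕ a) (toℕ<n a) p∣a) (sym toℕ-0#))
    where
    small : ∀ n → n < p → p ∣ n → n ≡ 0
    small zero    _   _   = refl
    small (suc n) n<p p∣n = contradiction (∣⇒≤ p∣n) (ℕ.<⇒≱ n<p)

  *-integral : ∀ a b → a * b ≡ 0# → a ≡ 0# ⊎ b ≡ 0#
  *-integral a b ab≡0 with euclidsLemma (toℕ a) (toℕ b) p-prime
                             (m%n≡0⇒n∣m _ p (trans (sym (toℕ⟦x⟧≡x%m _)) (trans (cong toℕ ab≡0) toℕ-0#)))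
  ... | inj₁ p∣a = inj₁ (divisible⇒≡0# a p∣a)
  ... | inj₂ p∣b = inj₂ (divisible⇒≡0# b p∣b)

  *-inverse : ∀ a → a ≢ 0# → ∃ λ b → a * b ≡ 1#
  *-inverse a a≢0 with coprime-Bézout coprime
    where
    coprime : Coprime (toℕ a) p
    coprime (d∣a , d∣p) with prime⇒irreducible p-prime d∣p
    ... | inj₁ d≡1 = d≡1
    ... | inj₂ refl = contradiction (divisible⇒≡0# a d∣a) a≢0
  ... | Bézout.+- x y 1+yp≡xa = ⟦ x ⟧ , (begin
    a * ⟦ x ⟧                  ≡⟨ cong (_* ⟦ x ⟧) (⟦toℕ⟧ a) ⟨
    ⟦ toℕ a ⟧ * ⟦ x ⟧          ≡⟨ ⟦x⟧*⟦y⟧≡⟦x*y⟧ (toℕ a) x ⟩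
    ⟦ toℕ a ℕ.* x ⟧            ≡⟨ cong ⟦_⟧ (trans (ℕ.*-comm (toℕ a) x) (sym 1+yp≡xa)) ⟩
    ⟦ 1 ℕ.+ y ℕ.* p ⟧          ≡⟨ x%m≡y%m⇒⟦x⟧≡⟦y⟧ ([m+kn]%n≡m%n 1 y p) ⟩
    1#                         ∎)
  ... | Bézout.-+ x y 1+xa≡yp = - ⟦ x ⟧ , trans (sym (-‿distribʳ-* a ⟦ x ⟧)) (sym (+-inverseʳ-unique _ _ ax+1≡0))
    where
    ax+1≡0 : (a * ⟦ x ⟧) + 1# ≡ 0#
    ax+1≡0 = begin
      (a * ⟦ x ⟧) + 1#             ≡⟨ cong (λ b → (b * ⟦ x ⟧) + 1#) (⟦toℕ⟧ a) ⟨
      (⟦ toℕ a ⟧ * ⟦ x ⟧) + ⟦ 1 ⟧  ≡⟨ cong (_+ ⟦ 1 ⟧) (⟦x⟧*⟦y⟧≡⟦x*y⟧ (toℕ a) x) ⟩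
      ⟦ toℕ a ℕ.* x ⟧ + ⟦ 1 ⟧      ≡⟨ ⟦x⟧+⟦y⟧≡⟦x+y⟧ (toℕ a ℕ.* x) 1 ⟩
      ⟦ toℕ a ℕ.* x ℕ.+ 1 ⟧         ≡⟨ cong ⟦_⟧ (trans (ℕ.+-comm _ 1) (trans (cong (1 ℕ.+_) (ℕ.*-comm (toℕ a) x)) 1+xa≡yp)) ⟩
      ⟦ y ℕ.* p ⟧                   ≡⟨ x%m≡y%m⇒⟦x⟧≡⟦y⟧ (trans (m*n%n≡0 y p) (sym (m<n⇒m%n≡m (ℕ.>-nonZero⁻¹ p)))) ⟩
      0#                            ∎

-- If -1 had no square root mod p, the Klein group {±a, ±a⁻¹} would act freely on F_p ∖ {0, 1, -1},
-- so 4 would divide p - 3.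
module SquareRootOfMinusOne (p : ℕ) (p-prime : Prime p) (j : ℕ) (p≡2j+1 : p ≡ suc (j ℕ.* 2)) (p≡1mod4 : p % 4 ≡ 1) where

  private instance
    p≢0 : NonZero p
    p≢0 = prime⇒nonZero p-prime

  open PrimeResidues p p-prime
  open IsOddAbelianGroup (OddResidues.isOddAbelianGroup p j p≡2j+1) using (≡-⇒≡0#; inverseˡ-unique; x∙y⁻¹≈ε⇒x≈y)

  -1# : Fin p
  -1# = - 1#

  inv : Fin p → Fin p
  inv a with a Fin.≟ 0#
  ... | yes _   = 0#
  ... | no a≢0 = proj₁ (*-inverse a a≢0)

  inv-inverse : ∀ {a : Fin p} → a ≢ 0# → a * inv a ≡ 1#
  inv-inverse {a} a≢0 with a Fin.≟ 0#
  ... | yes a≡0  = contradiction a≡0 a≢0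
  ... | no a≢0′ = proj₂ (*-inverse a a≢0′)

  inverse-unique : ∀ {a b c : Fin p} → a * b ≡ 1# → a * c ≡ 1# → b ≡ c
  inverse-unique {a} {b} {c} ab≡1 ac≡1 = begin
    b              ≡⟨ *-identityʳ b ⟨
    b * 1#         ≡⟨ cong (b *_) ac≡1 ⟨
    b * (a * c)    ≡⟨ *-assoc b a c ⟨
    (b * a) * c    ≡⟨ cong (_* c) (trans (*-comm b a) ab≡1) ⟩
    1# * c         ≡⟨ *-identityˡ c ⟩
    c              ∎

  inv-unique : ∀ a {b} → a * b ≡ 1# → inv a ≡ b
  inv-unique a {b} ab≡1 = inverse-unique {a} (inv-inverse a≢0) ab≡1
    where
    a≢0 : a ≢ 0#
    a≢0 refl = 1#≢0# (trans (sym ab≡1) (zeroˡ b))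

  inv-0# : inv 0# ≡ 0#
  inv-0# with 0# Fin.≟ 0#
  ... | yes _    = refl
  ... | no 0≢0 = contradiction refl 0≢0

  inv-involutive : ∀ a → inv (inv a) ≡ a
  inv-involutive a = by-cases (a Fin.≟ 0#)
    where
    by-cases : Dec (a ≡ 0#) → inv (inv a) ≡ a
    by-cases (yes refl) = trans (cong inv inv-0#) inv-0#
    by-cases (no a≢0)   = inv-unique (inv a) (trans (*-comm (inv a) a) (inv-inverse a≢0))

  -‿*-‿ : ∀ a b → (- a) * (- b) ≡ a * b
  -‿*-‿ a b = begin
    (- a) * (- b)   ≡⟨ -‿distribˡ-* a (- b) ⟨
    - (a * (- b))   ≡⟨ cong -_ (-‿distribʳ-* a b) ⟨
    - - (a * b)     ≡⟨ -‿involutive _ ⟩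
    a * b           ∎

  inv-‿ : ∀ a → inv (- a) ≡ - inv a
  inv-‿ a = by-cases (a Fin.≟ 0#)
    where
    by-cases : Dec (a ≡ 0#) → inv (- a) ≡ - inv a
    by-cases (yes refl) = trans (cong inv -0#≈0#) (trans inv-0# (sym (trans (cong -_ inv-0#) -0#≈0#)))
    by-cases (no a≢0)   = inv-unique (- a) (begin
      (- a) * (- inv a)   ≡⟨ -‿*-‿ a (inv a) ⟩
      a * inv a           ≡⟨ inv-inverse a≢0 ⟩
      1#                  ∎)

  square≡1 : ∀ {a} → a * a ≡ 1# → a ≡ 1# ⊎ a ≡ -1#
  square≡1 {a} a²≡1 with *-integral (a + -1#) (a + 1#) (begin
    (a + -1#) * (a + 1#)                   ≡⟨ [y-z]x≈yx-zx (a + 1#) a 1# ⟩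
    (a * (a + 1#)) + - (1# * (a + 1#))   ≡⟨ cong₂ (λ u v → u + - v) (distribˡ a a 1#) (*-identityˡ _) ⟩
    ((a * a) + (a * 1#)) + - (a + 1#)    ≡⟨ cong (λ u → u + - (a + 1#)) (cong₂ _+_ a²≡1 (*-identityʳ a)) ⟩
    (1# + a) + - (a + 1#)                ≡⟨ cong (λ u → u + - (a + 1#)) (+-comm 1# a) ⟩
    (a + 1#) + - (a + 1#)                ≡⟨ -‿inverseʳ (a + 1#) ⟩
    0#                                       ∎)
  ... | inj₁ a-1≡0 = inj₁ (x∙y⁻¹≈ε⇒x≈y a 1# a-1≡0)
  ... | inj₂ a+1≡0 = inj₂ (inverseˡ-unique a 1# a+1≡0)

  IsExceptional : Fin p → Set
  IsExceptional a = a ≡ 0# ⊎ a ≡ 1# ⊎ a ≡ -1#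

  IsExceptional? : ∀ a → Dec (IsExceptional a)
  IsExceptional? a = (a Fin.≟ 0#) ⊎-dec (a Fin.≟ 1#) ⊎-dec (a Fin.≟ -1#)

  exceptional-‿ : ∀ {a} → IsExceptional a → IsExceptional (- a)
  exceptional-‿ (inj₁ refl)        = inj₁ -0#≈0#
  exceptional-‿ (inj₂ (inj₁ refl)) = inj₂ (inj₂ refl)
  exceptional-‿ (inj₂ (inj₂ refl)) = inj₂ (inj₁ (-‿involutive 1#))

  exceptional-inv : ∀ {a} → IsExceptional a → IsExceptional (inv a)
  exceptional-inv (inj₁ refl)        = inj₁ inv-0#
  exceptional-inv (inj₂ (inj₁ refl)) = inj₂ (inj₁ (inv-unique 1# (*-identityˡ 1#)))
  exceptional-inv (inj₂ (inj₂ refl)) = inj₂ (inj₂ (inv-unique -1# (trans (-‿*-‿ 1# 1#) (*-identityˡ 1#))))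

  0≢1 : 0# ≢ 1#
  0≢1 = 1#≢0# ∘ sym

  0≢-1 : 0# ≢ -1#
  0≢-1 0≡-1 = 0≢1 (trans (sym -0#≈0#) (trans (cong -_ 0≡-1) (-‿involutive 1#)))

  1≢-1 : 1# ≢ -1#
  1≢-1 = 1#≢0# ∘ ≡-⇒≡0#

  exceptional : List (Fin p)
  exceptional = 0# ∷ 1# ∷ -1# ∷ []

  module NoSquareRoot (no-root : ∀ a → a * a ≢ -1#) where

    module Klein = FourGroup -_ inv false -‿involutive (λ a → sym (inv-‿ a)) inv-involutive

    moves : ∀ {a} → ¬ IsExceptional a → - a ≢ a × inv a ≢ a × - inv a ≢ a
    moves {a} ¬exc = (λ -a≡a → ¬exc (inj₁ (≡-⇒≡0# (sym -a≡a))))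
                   , (λ inv-a≡a → ¬exc (inj₂ (square≡1 (trans (cong (a *_) (sym inv-a≡a)) (inv-inverse a≢0)))))
                   , λ -inv-a≡a → no-root a (begin
                       a * a           ≡⟨ -‿involutive (a * a) ⟨
                       - - (a * a)     ≡⟨ cong -_ (-‿distribʳ-* a a) ⟩
                       - (a * (- a))   ≡⟨ cong (λ b → - (a * b)) (trans (sym (-‿involutive (inv a))) (cong -_ -inv-a≡a)) ⟨
                       - (a * inv a)   ≡⟨ cong -_ (inv-inverse a≢0) ⟩
                       -1#             ∎)
      where
      a≢0 : a ≢ 0#
      a≢0 = ¬exc ∘ inj₁

    open Orbits Klein._≟_ Fin._≟_ (¬? ∘ IsExceptional?)
                (Klein.freeAction exceptional-‿ exceptional-inv moves)
                Klein.elements Klein.elements-enumeration (allFin p) (allFin-enumeration p)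
    open Count (Fin._≟_ {p})

    count-exceptional : ∀ {a} → IsExceptional a → count a exceptional ≡ 1
    count-exceptional (inj₁ refl)        =
      trans (count-here 0# _) $ cong suc (trans (count-there 0# 1# _ 0≢1) (count-there 0# -1# [] 0≢-1))
    count-exceptional (inj₂ (inj₁ refl)) =
      trans (count-there 1# 0# _ (0≢1 ∘ sym)) (trans (count-here 1# _) (cong suc (count-there 1# -1# [] 1≢-1)))
    count-exceptional (inj₂ (inj₂ refl)) =
      trans (count-there -1# 0# _ (0≢-1 ∘ sym)) (trans (count-there -1# 1# _ (1≢-1 ∘ sym)) (count-here -1# []))

    count-unexceptional : ∀ {a} → ¬ IsExceptional a → count a exceptional ≡ 0
    count-unexceptional {a} ¬exc =
      trans (count-there a 0# _ (¬exc ∘ inj₁))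
            (trans (count-there a 1# _ (¬exc ∘ inj₂ ∘ inj₁)) (count-there a -1# [] (¬exc ∘ inj₂ ∘ inj₂)))

    orbits++exceptional-enumeration : IsEnumeration (orbits Klein.elements ++ exceptional)
    orbits++exceptional-enumeration a = trans (count-++ a (orbits Klein.elements) exceptional) (by-cases (IsExceptional? a))
      where
      by-cases : Dec (IsExceptional a) → count a (orbits Klein.elements) ℕ.+ count a exceptional ≡ 1
      by-cases (yes exc)  = cong₂ ℕ._+_ (orbits-avoid Klein.elements Klein.elements-enumeration (λ ¬exc → ¬exc exc))
                                        (count-exceptional exc)
      by-cases (no ¬exc) = cong₂ ℕ._+_ (orbits-cover Klein.elements Klein.elements-enumeration ¬exc)
                                        (count-unexceptional ¬exc)

    p≡3+4r : p ≡ 3 ℕ.+ length Reps ℕ.* 4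
    p≡3+4r = begin
      p                                                ≡⟨ length-tabulate id ⟨
      length (allFin p)                                ≡⟨ enumeration-length (allFin p) (orbits Klein.elements ++ exceptional)
                                                                             (allFin-enumeration p) orbits++exceptional-enumeration ⟩
      length (orbits Klein.elements ++ exceptional)    ≡⟨ length-++ (orbits Klein.elements) ⟩
      length (orbits Klein.elements) ℕ.+ 3             ≡⟨ cong (ℕ._+ 3) (length-orbits Klein.elements) ⟩
      length Reps ℕ.* 4 ℕ.+ 3                          ≡⟨ ℕ.+-comm _ 3 ⟩
      3 ℕ.+ length Reps ℕ.* 4                          ∎

    p≡3mod4 : p % 4 ≡ 3
    p≡3mod4 = trans (cong (_% 4) p≡3+4r) ([m+kn]%n≡m%n 3 (length Reps) 4)

  √-1 : ∃ λ ι → ι * ι ≡ -1#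
  √-1 with any? (λ a → (a * a) Fin.≟ -1#)
  ... | yes root = root
  ... | no ¬root = contradiction (trans (sym p≡1mod4) (NoSquareRoot.p≡3mod4 (λ a a²≡-1 → ¬root (a , a²≡-1)))) λ ()

module ParityMod4 where

  open import Data.Nat using (_+_; _*_)
  open import Data.Nat.Properties using (*-assoc; *-comm; *-identityʳ)

  data Parity : ℕ → Set where
    even : ∀ j → Parity (j * 2)
    odd  : ∀ j → Parity (suc (j * 2))

  parity : ∀ n → Parity n
  parity zero    = even 0
  parity (suc n) with parity n
  ... | even j = odd j
  ... | odd j  = even (suc j)

  odd²≡1mod4 : ∀ j → (suc (j * 2) * suc (j * 2)) % 4 ≡ 1
  odd²≡1mod4 j = trans (cong (_% 4) (+-*-Solver.solve 1 (λ j → (con 1 :+ j :* con 2) :* (con 1 :+ j :* con 2)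
                                                          := con 1 :+ (j :* j :+ j) :* con 4) refl j))
                       ([m+kn]%n≡m%n 1 (j * j + j) 4)
    where open +-*-Solver using (_:+_; _:*_; _:=_; con)

  odd^even≡1mod4 : ∀ j k → (suc (j * 2) ^ (k * 2)) % 4 ≡ 1
  odd^even≡1mod4 j zero    = refl
  odd^even≡1mod4 j (suc k) = begin
    (b * (b * b ^ (k * 2))) % 4          ≡⟨ cong (_% 4) (*-assoc b b (b ^ (k * 2))) ⟨
    (b * b * b ^ (k * 2)) % 4            ≡⟨ %-distribˡ-* (b * b) (b ^ (k * 2)) 4 ⟩
    (((b * b) % 4) * (b ^ (k * 2) % 4)) % 4  ≡⟨ ones (odd²≡1mod4 j) (odd^even≡1mod4 j k) ⟩
    1                                    ∎
    where
    b : ℕ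
    b = suc (j * 2)
    ones : ∀ {x y} → x ≡ 1 → y ≡ 1 → (x * y) % 4 ≡ 1
    ones refl refl = refl

  odd-base : ∀ b e → 1 ≤ e → (b ^ e) % 4 ≡ 1 → ∃ λ j → b ≡ suc (j * 2)
  odd-base b (suc e) _ b^e≡1 with parity b
  ... | odd j  = j , refl
  ... | even j = contradiction (trans (sym b^e%2≡1) b^e%2≡0) λ ()
    where
    b^e%2≡1 : (j * 2 * (j * 2) ^ e) % 2 ≡ 1
    b^e%2≡1 = trans (sym (m∣n⇒o%n%m≡o%m 2 4 (j * 2 * (j * 2) ^ e) (divides 2 refl))) (cong (_% 2) b^e≡1)
    b^e%2≡0 : (j * 2 * (j * 2) ^ e) % 2 ≡ 0
    b^e%2≡0 = trans (cong (_% 2) (+-*-Solver.solve 2 (λ j x → j :* con 2 :* x := j :* x :* con 2) refl j ((j * 2) ^ e)))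
                    (m*n%n≡0 (j * (j * 2) ^ e) 2)
      where open +-*-Solver using (_:*_; _:=_; con)

  odd-power≡base-mod4 : ∀ j k → (suc (j * 2) ^ suc (k * 2)) % 4 ≡ suc (j * 2) % 4
  odd-power≡base-mod4 j k = begin
    (b * b ^ (k * 2)) % 4               ≡⟨ %-distribˡ-* b (b ^ (k * 2)) 4 ⟩
    ((b % 4) * (b ^ (k * 2) % 4)) % 4   ≡⟨ cong (λ x → ((b % 4) * x) % 4) (odd^even≡1mod4 j k) ⟩
    ((b % 4) * 1) % 4                   ≡⟨ cong (_% 4) (*-identityʳ (b % 4)) ⟩
    b % 4 % 4                           ≡⟨ m%n%n≡m%n b 4 ⟩
    b % 4                               ∎
    where
    b : ℕ
    b = suc (j * 2)

open ParityMod4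

module _ (b : ℕ) (b-prime : Prime b) where

  open import Data.Nat using (_*_)

  private instance
    b≢0 : NonZero b
    b≢0 = prime⇒nonZero b-prime

  Fq-isGaussianModule : ∀ n → 1 ≤ n → (b ^ n) % 4 ≡ 1 →
                        IsGaussianModule {_+_ = Vec.zipWith {n = n} (_+ₘ_ {b})} {Vec.replicate n 0ₘ} { Vec.map -ₘ_ }
  Fq-isGaussianModule n 1≤n bⁿ≡1 with odd-base b n 1≤n bⁿ≡1
  ... | j , b≡2j+1 = by-parity (parity n) bⁿ≡1
    where
    open Residues b using (+-*-isCommutativeRing)
    open OddResidues b j b≡2j+1 using (½; ½+½≡1; isOddAbelianGroup)
    by-parity : ∀ {n} → Parity n → (b ^ n) % 4 ≡ 1 →
                IsGaussianModule {_+_ = Vec.zipWith {n = n} (_+ₘ_ {b})} {Vec.replicate n 0ₘ} { Vec.map -ₘ_ }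
    by-parity (even k) _    = rotation-isGaussianModule isOddAbelianGroup k
    by-parity (odd k)  bⁿ≡1 =
      vec-isGaussianModule (ring-isGaussianModule +-*-isCommutativeRing ½ ½+½≡1 (proj₁ √-1) (proj₂ √-1)) _
      where
      b≡1mod4 : b % 4 ≡ 1
      b≡1mod4 = trans (sym (subst (λ x → (x ^ suc (k * 2)) % 4 ≡ x % 4) (sym b≡2j+1) (odd-power≡base-mod4 j k))) bⁿ≡1
      open SquareRootOfMinusOne b b-prime j b≡2j+1 b≡1mod4 using (√-1)

V-isGaussianModule : ∀ cs → (∀ c → c ∈ cs → 1 ≤ e c × qOf c % 4 ≡ 1) →
                     IsGaussianModule {_+_ = addV cs} {zeroV cs} {negV cs}
V-isGaussianModule []       _          = ⊤-isGaussianModule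
V-isGaussianModule (c ∷ cs) components =
  ×-isGaussianModule (Fq-isGaussianModule (p c) (prime c) (e c) 1≤e q≡1mod4)
                     (V-isGaussianModule cs (λ c′ → components c′ ∘ there))
  where
  1≤e : 1 ≤ e c
  1≤e = proj₁ (components c (here refl))
  q≡1mod4 : qOf c % 4 ≡ 1
  q≡1mod4 = proj₂ (components c (here refl))

-- The construction

module Construction (cs : List Comp) (M : IsGaussianModule {_+_ = addV cs} {zeroV cs} {negV cs}) where

  open IsGaussianModule M

  infixl 6 _+_ _-_
  infix  8 -_

  _+_ : V cs → V cs → V cs
  _+_ = addV cs

  -_ : V cs → V cs
  -_ = negV cs

  0# : V cs
  0# = zeroV cs

  _-_ : V cs → V cs → V cs
  x - y = x + - y

  [t+x]-[t+y] : ∀ t x y → (t + x) - (t + y) ≡ x - y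
  [t+x]-[t+y] t x y = begin
    (t + x) + - (t + y)      ≡⟨ cong ((t + x) +_) (⁻¹-∙-comm t y) ⟨
    (t + x) + (- t + - y)    ≡⟨ interchange t x (- t) (- y) ⟩
    (t - t) + (x - y)        ≡⟨ cong (_+ (x - y)) (inverseʳ t) ⟩
    0# + (x - y)             ≡⟨ identityˡ (x - y) ⟩
    x - y                    ∎

  [t+x]-t : ∀ t x → (t + x) - t ≡ x
  [t+x]-t t x = begin
    (t + x) - t              ≡⟨ cong (λ u → (t + x) - u) (identityʳ t) ⟨
    (t + x) - (t + 0#)       ≡⟨ [t+x]-[t+y] t x 0# ⟩
    x + - 0#                 ≡⟨ cong (x +_) ε⁻¹≈ε ⟩
    x + 0#                   ≡⟨ identityʳ x ⟩
    x                        ∎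

  t-[t+x] : ∀ t x → t - (t + x) ≡ - x
  t-[t+x] t x = begin
    t - (t + x)              ≡⟨ cong (_- (t + x)) (identityʳ t) ⟨
    (t + 0#) - (t + x)       ≡⟨ [t+x]-[t+y] t 0# x ⟩
    0# - x                   ≡⟨ identityˡ (- x) ⟩
    - x                      ∎

  -t+[t+x] : ∀ t x → - t + (t + x) ≡ x
  -t+[t+x] t x = trans (sym (assoc (- t) t x)) (trans (cong (_+ x) (inverseˡ t)) (identityˡ x))

  _⊖_ : Fin 3 → Fin 3 → Fin 3
  a ⊖ b = a +ₘ (-ₘ b)

  baseBlock : (a b : Fin 3) → a ≢ b → (t g : V cs) → g ≢ 0# → Block cs
  baseBlock a b a≢b t g g≢0 =
    block (a , t + g) (a , t - g) (b , t)
          (g≢0 ∘ ≡-⇒≡0# ∘ ∙-cancelˡ t g (- g) ∘ cong proj₂) (a≢b ∘ cong proj₁) (a≢b ∘ cong proj₁)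

  differences : Fin 3 → Fin 3 → V cs → List (G cs)
  differences a b g =
    (a ⊖ a , g + g) ∷ (a ⊖ a , - (g + g)) ∷ (a ⊖ b , g) ∷ (b ⊖ a , - g) ∷ (a ⊖ b , - g) ∷ (b ⊖ a , g) ∷ []

  diffs-baseBlock : ∀ a b a≢b t g g≢0 → diffs (baseBlock a b a≢b t g g≢0) ≡ differences a b g
  diffs-baseBlock a b _ t g _ =
    cong₂ _∷_ (cong (a ⊖ a ,_) (trans ([t+x]-[t+y] t g (- g)) (cong (g +_) (⁻¹-involutive g)))) $
    cong₂ _∷_ (cong (a ⊖ a ,_) (trans ([t+x]-[t+y] t (- g) g) (⁻¹-∙-comm g g))) $
    cong₂ _∷_ (cong (a ⊖ b ,_) ([t+x]-t t g)) $
    cong₂ _∷_ (cong (b ⊖ a ,_) (t-[t+x] t g)) $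
    cong₂ _∷_ (cong (a ⊖ b ,_) ([t+x]-t t (- g))) $
    cong (λ v → (b ⊖ a , v) ∷ []) (trans (t-[t+x] t (- g)) (⁻¹-involutive g))

  baseBlock-translate : ∀ a b a≢b t t′ g g≢0 →
                        IsTranslateOf (baseBlock a b a≢b t′ g g≢0) (baseBlock a b a≢b t g g≢0)
  baseBlock-translate a b _ t t′ g _ = (0ₘ , t′ - t) , ↭-reflexive (sym (
    cong₂ _∷_ (cong₂ _,_ (+₃-identityʳ a) (shift g)) $
    cong₂ _∷_ (cong₂ _,_ (+₃-identityʳ a) (shift (- g))) $
    cong (_∷ []) (cong₂ _,_ (+₃-identityʳ b) (trans (comm t (t′ - t)) (trans (assoc t′ (- t) t)
                                                   (trans (cong (t′ +_) (inverseˡ t)) (identityʳ t′)))))))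
    where
    open IsAbelianGroup (Residues.+-isAbelianGroup 3) using () renaming (identityʳ to +₃-identityʳ)
    shift : ∀ x → (t + x) + (t′ - t) ≡ t′ + x
    shift x = trans (comm (t + x) (t′ - t)) (trans (assoc t′ (- t) (t + x)) (cong (t′ +_) (-t+[t+x] t x)))

  open Orbits Units._≟_ (decV cs) (λ x → ¬? (decV cs x 0#)) units Units.elements Units.elements-enumeration
              (allV cs) (allV-enumeration cs)
  open Count (decV cs)
  -- G.count is Defs.count cs.
  private module G = Count (decG cs)

  image-orbits-partition :
    ∀ ks → Count.IsEnumeration Units._≟_ ks → ∀ (f f⁻¹ : V cs → V cs) →
    (∀ x → f (- x) ≡ - f x) → (∀ x → f (i x) ≡ i (f x)) →
    (∀ x → f⁻¹ (f x) ≡ x) → (∀ y → f (f⁻¹ y) ≡ y) →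
    ∀ l v → count v (concatMap (orbit ks ∘ f ∘ proj₁) Reps) ≡ indG∖H cs (l , v)
  image-orbits-partition ks ks-enum f f⁻¹ f-‿ f-i f⁻¹-f f-f⁻¹ l v =
    trans (count-orbits-image ks f f⁻¹ (units-equivariant f f-‿ f-i) f⁻¹-f f-f⁻¹ v) (by-cases (decV cs v 0#))
    where
    f0≡0 : f 0# ≡ 0#
    f0≡0 = ≡-⇒≡0# (trans (cong f (sym ε⁻¹≈ε)) (f-‿ 0#))
    by-cases : (d : Dec (v ≡ 0#)) → count (f⁻¹ v) (orbits ks) ≡ (if ⌊ d ⌋ then 0 else 1)
    by-cases (yes refl) = orbits-avoid ks ks-enum (λ f⁻¹0≢0 → f⁻¹0≢0 (trans (cong f⁻¹ (sym f0≡0)) (f⁻¹-f 0#)))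
    by-cases (no v≢0)   =
      orbits-cover ks ks-enum (λ f⁻¹v≡0 → v≢0 (trans (sym (f-f⁻¹ v)) (trans (cong f f⁻¹v≡0) f0≡0)))

  pairDifferences : V cs → List (G cs)
  pairDifferences x = differences 0F 2F x ++ differences 1F 2F (i x)

  module _ (r : ∃ IsRep) where
    private
      x : V cs
      x = proj₁ r
      x≢0 : x ≢ 0#
      x≢0 = proj₁ (proj₂ r)
      ix≢0 : i x ≢ 0#
      ix≢0 = FreeAction.act-D units (false , true) x≢0

    B₀ B₁ B₀′ B₁′ : Block cs
    B₀  = baseBlock 0F 2F (λ ()) (i x) x x≢0
    B₁  = baseBlock 1F 2F (λ ()) (- x) (i x) ix≢0
    B₀′ = baseBlock 0F 2F (λ ()) (- i x) x x≢0
    B₁′ = baseBlock 1F 2F (λ ()) x (i x) ix≢0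

    diffs-B₀B₁ : concatMap diffs (B₀ ∷ B₁ ∷ []) ≡ pairDifferences x
    diffs-B₀B₁ = cong₂ _++_ (diffs-baseBlock 0F 2F (λ ()) (i x) x x≢0)
                            (trans (++-identityʳ _) (diffs-baseBlock 1F 2F (λ ()) (- x) (i x) ix≢0))

    B₀′-translate : IsTranslateOf B₀′ B₀
    B₀′-translate = baseBlock-translate 0F 2F (λ ()) (i x) (- i x) x x≢0

    B₁′-translate : IsTranslateOf B₁′ B₁
    B₁′-translate = baseBlock-translate 1F 2F (λ ()) (- x) x (i x) ix≢0

    diffs-B₀′B₁′ : concatMap diffs (B₀′ ∷ B₁′ ∷ []) ≡ pairDifferences x
    diffs-B₀′B₁′ = cong₂ _++_ (diffs-baseBlock 0F 2F (λ ()) (- i x) x x≢0)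
                              (trans (++-identityʳ _) (diffs-baseBlock 1F 2F (λ ()) x (i x) ix≢0))

  family family′ : List (Block cs)
  family  = concatMap (λ r → B₀ r ∷ B₁ r ∷ []) Reps
  family′ = concatMap (λ r → B₀′ r ∷ B₁′ r ∷ []) Reps

  level : Fin 3 → List (G cs) → List (V cs)
  level = atLevel Fin._≟_ (decV cs)

  count-level : ∀ l v xs → G.count (l , v) xs ≡ count v (level l xs)
  count-level = count-atLevel Fin._≟_ (decV cs)

  level-concatMap : ∀ {C : Set} l (f : C → List (G cs)) zs → level l (concatMap f zs) ≡ concatMap (level l ∘ f) zs
  level-concatMap = atLevel-concatMap Fin._≟_ (decV cs)

  diffs-family : concatMap diffs family ≡ concatMap (pairDifferences ∘ proj₁) Reps
  diffs-family = trans (concatMap-concatMap diffs _ Reps) (concatMap-cong diffs-B₀B₁ Reps)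

  diffs-family′ : concatMap diffs family′ ≡ concatMap (pairDifferences ∘ proj₁) Reps
  diffs-family′ = trans (concatMap-concatMap diffs _ Reps) (concatMap-cong diffs-B₀′B₁′ Reps)

  count-differences : ∀ g → G.count g (concatMap (pairDifferences ∘ proj₁) Reps) ≡ indG∖H cs g
  count-differences (l , v) = begin
    G.count (l , v) (concatMap (pairDifferences ∘ proj₁) Reps)
      ≡⟨ count-level l v (concatMap (pairDifferences ∘ proj₁) Reps) ⟩
    count v (level l (concatMap (pairDifferences ∘ proj₁) Reps))
      ≡⟨ cong (count v) (level-concatMap l (pairDifferences ∘ proj₁) Reps) ⟩
    count v (concatMap (level l ∘ pairDifferences ∘ proj₁) Reps)
      ≡⟨ at-level l ⟩
    indG∖H cs (l , v)
      ∎
    where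
    ks₀ ks₁ ks₂ : List Units.K
    ks₀ = (false , false) ∷ (true , false) ∷ (false , true) ∷ (true , true) ∷ []
    ks₁ = (false , false) ∷ (true , false) ∷ (true , true) ∷ (false , true) ∷ []
    ks₂ = (true , false) ∷ (false , false) ∷ (false , true) ∷ (true , true) ∷ []
    level₀ : ∀ x → level 0F (pairDifferences x) ≡ orbit ks₀ (x + x)
    level₀ x = cong (λ u → x + x ∷ - (x + x) ∷ u ∷ - u ∷ []) (sym (i-+ x x))
    at-level : ∀ l → count v (concatMap (level l ∘ pairDifferences ∘ proj₁) Reps) ≡ indG∖H cs (l , v)
    at-level 0F = trans (cong (count v) (concatMap-cong (level₀ ∘ proj₁) Reps))
                        (image-orbits-partition ks₀
                           (Units.enumeration-by-cases ks₀ refl refl refl refl)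
                           (λ x → x + x) half (λ x → ⁻¹-∙-comm x x) (λ x → sym (i-+ x x)) half-double double-half 0F v)
    at-level 1F = image-orbits-partition ks₁
                    (Units.enumeration-by-cases ks₁ refl refl refl refl)
                    (λ x → x) (λ x → x) (λ _ → refl) (λ _ → refl) (λ _ → refl) (λ _ → refl) 1F v
    at-level 2F = image-orbits-partition ks₂
                    (Units.enumeration-by-cases ks₂ refl refl refl refl)
                    (λ x → x) (λ x → x) (λ _ → refl) (λ _ → refl) (λ _ → refl) (λ _ → refl) 2F v

  1+i [1+i]⁻¹ : V cs → V cs
  1+i x      = x + i x
  [1+i]⁻¹ y = half (y - i y)

  i[1+i] : ∀ x → i (1+i x) ≡ i x - x
  i[1+i] x = trans (i-+ x (i x)) (cong (i x +_) (i-i x))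

  -i[1+i] : ∀ x → - i (1+i x) ≡ - i x + x
  -i[1+i] x = trans (cong -_ (i[1+i] x)) (trans (sym (⁻¹-∙-comm (i x) (- x))) (cong (- i x +_) (⁻¹-involutive x)))

  [1+i]-‿ : ∀ x → 1+i (- x) ≡ - 1+i x
  [1+i]-‿ x = trans (cong (- x +_) (i-‿ x)) (⁻¹-∙-comm x (i x))

  [1+i]-i : ∀ x → 1+i (i x) ≡ i (1+i x)
  [1+i]-i x = sym (i-+ x (i x))

  [1+i]⁻¹-[1+i] : ∀ x → [1+i]⁻¹ (1+i x) ≡ x
  [1+i]⁻¹-[1+i] x = begin
    half ((x + i x) - i (1+i x))    ≡⟨ cong (λ u → half ((x + i x) - u)) (i[1+i] x) ⟩
    half ((x + i x) - (i x - x))    ≡⟨ cong (λ u → half (u - (i x - x))) (comm x (i x)) ⟩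
    half ((i x + x) - (i x - x))    ≡⟨ cong half ([t+x]-[t+y] (i x) x (- x)) ⟩
    half (x - - x)                  ≡⟨ cong (λ u → half (x + u)) (⁻¹-involutive x) ⟩
    half (x + x)                    ≡⟨ half-double x ⟩
    x                               ∎

  [1+i]-[1+i]⁻¹ : ∀ y → 1+i ([1+i]⁻¹ y) ≡ y
  [1+i]-[1+i]⁻¹ y = begin
    half (y - i y) + i (half (y - i y))        ≡⟨ cong (half (y - i y) +_) (half-homomorphism i i-+ (y - i y)) ⟨
    half (y - i y) + half (i (y - i y))        ≡⟨ half-+ (y - i y) _ ⟨
    half ((y - i y) + i (y - i y))             ≡⟨ cong (λ u → half ((y - i y) + u)) i[y-iy] ⟩
    half ((y - i y) + (y + i y))               ≡⟨ cong half (interchange y (- i y) y (i y)) ⟩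
    half ((y + y) + (- i y + i y))             ≡⟨ cong (λ u → half ((y + y) + u)) (inverseˡ (i y)) ⟩
    half ((y + y) + 0#)                        ≡⟨ cong half (identityʳ (y + y)) ⟩
    half (y + y)                               ≡⟨ half-double y ⟩
    y                                          ∎
    where
    i[y-iy] : i (y - i y) ≡ y + i y
    i[y-iy] = begin
      i (y - i y)        ≡⟨ i-+ y (- i y) ⟩
      i y + i (- i y)    ≡⟨ cong (i y +_) (trans (i-‿ (i y)) (cong -_ (i-i y))) ⟩
      i y + - - y        ≡⟨ cong (i y +_) (⁻¹-involutive y) ⟩
      i y + y            ≡⟨ comm (i y) y ⟩
      y + i y            ∎

  ∷₄-cong : ∀ {a b c d a′ b′ c′ d′ : V cs} → a ≡ a′ → b ≡ b′ → c ≡ c′ → d ≡ d′ →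
            _≡_ {A = List (V cs)} (a ∷ b ∷ c ∷ d ∷ []) (a′ ∷ b′ ∷ c′ ∷ d′ ∷ [])
  ∷₄-cong refl refl refl refl = refl

  pairElements pairElements′ : ∃ IsRep → List (G cs)
  pairElements  r = concatMap elems (B₀ r ∷ B₁ r ∷ [])
  pairElements′ r = concatMap elems (B₀′ r ∷ B₁′ r ∷ [])

  count-elements : ∀ g → G.count g (concatMap elems (family ++ family′)) ≡ indG∖H cs g
  count-elements (l , v) = begin
    G.count (l , v) (concatMap elems (family ++ family′))
      ≡⟨ cong (G.count (l , v)) (concatMap-++ elems family family′) ⟩
    G.count (l , v) (concatMap elems family ++ concatMap elems family′)
      ≡⟨ G.count-++ (l , v) (concatMap elems family) (concatMap elems family′) ⟩
    G.count (l , v) (concatMap elems family) ℕ.+ G.count (l , v) (concatMap elems family′)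
      ≡⟨ cong₂ ℕ._+_ (count-family (λ r → B₀ r ∷ B₁ r ∷ [])) (count-family (λ r → B₀′ r ∷ B₁′ r ∷ [])) ⟩
    count v (concatMap (level l ∘ pairElements) Reps) ℕ.+ count v (concatMap (level l ∘ pairElements′) Reps)
      ≡⟨ count-concatMap-++ v (level l ∘ pairElements) (level l ∘ pairElements′) Reps ⟩
    count v (concatMap (λ r → level l (pairElements r) ++ level l (pairElements′ r)) Reps)
      ≡⟨ at-level l ⟩
    indG∖H cs (l , v)
      ∎
    where
    count-family : ∀ (pair : ∃ IsRep → List (Block cs)) →
                   G.count (l , v) (concatMap elems (concatMap pair Reps))
                   ≡ count v (concatMap (level l ∘ concatMap elems ∘ pair) Reps)
    count-family pair = begin
      G.count (l , v) (concatMap elems (concatMap pair Reps))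
        ≡⟨ count-level l v (concatMap elems (concatMap pair Reps)) ⟩
      count v (level l (concatMap elems (concatMap pair Reps)))
        ≡⟨ cong (count v ∘ level l) (concatMap-concatMap elems pair Reps) ⟩
      count v (level l (concatMap (concatMap elems ∘ pair) Reps))
        ≡⟨ cong (count v) (level-concatMap l (concatMap elems ∘ pair) Reps) ⟩
      count v (concatMap (level l ∘ concatMap elems ∘ pair) Reps)
        ∎
    ks₀ ks₁ ks₂ : List Units.K
    ks₀ = (false , false) ∷ (false , true) ∷ (true , true) ∷ (true , false) ∷ []
    ks₁ = (false , true) ∷ (true , false) ∷ (false , false) ∷ (true , true) ∷ []
    ks₂ = (false , true) ∷ (true , false) ∷ (true , true) ∷ (false , false) ∷ []
    level₀ : ∀ r → level 0F (pairElements r) ++ level 0F (pairElements′ r) ≡ orbit ks₀ (1+i (proj₁ r))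
    level₀ (x , _) = ∷₄-cong (comm (i x) x) (sym (i[1+i] x)) (sym (-i[1+i] x))
                             (trans (⁻¹-∙-comm (i x) x) (cong -_ (comm (i x) x)))
    level₁ : ∀ r → level 1F (pairElements r) ++ level 1F (pairElements′ r) ≡ orbit ks₁ (1+i (proj₁ r))
    level₁ (x , _) = ∷₄-cong (trans (comm (- x) (i x)) (sym (i[1+i] x))) (⁻¹-∙-comm x (i x)) refl
                             (trans (comm x (- i x)) (sym (-i[1+i] x)))
    at-level : ∀ l → count v (concatMap (λ r → level l (pairElements r) ++ level l (pairElements′ r)) Reps)
                     ≡ indG∖H cs (l , v)
    at-level 0F = trans (cong (count v) (concatMap-cong level₀ Reps))
                        (image-orbits-partition ks₀
                           (Units.enumeration-by-cases ks₀ refl refl refl refl)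
                           1+i [1+i]⁻¹ [1+i]-‿ [1+i]-i [1+i]⁻¹-[1+i] [1+i]-[1+i]⁻¹ 0F v)
    at-level 1F = trans (cong (count v) (concatMap-cong level₁ Reps))
                        (image-orbits-partition ks₁
                           (Units.enumeration-by-cases ks₁ refl refl refl refl)
                           1+i [1+i]⁻¹ [1+i]-‿ [1+i]-i [1+i]⁻¹-[1+i] [1+i]-[1+i]⁻¹ 1F v)
    at-level 2F = image-orbits-partition ks₂
                    (Units.enumeration-by-cases ks₂ refl refl refl refl)
                    (λ x → x) (λ x → x) (λ _ → refl) (λ _ → refl) (λ _ → refl) (λ _ → refl) 2F v

  family′-stronglyEquivalent : StronglyEquivalent family′ family
  family′-stronglyEquivalent = go Reps
    where
    go : ∀ rs → Pointwise.Pointwise IsTranslateOf (concatMap (λ r → B₀′ r ∷ B₁′ r ∷ []) rs)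
                                                  (concatMap (λ r → B₀ r ∷ B₁ r ∷ []) rs)
    go []       = Pointwise.[]
    go (r ∷ rs) = B₀′-translate r Pointwise.∷ B₁′-translate r Pointwise.∷ go rs

  doublyDisjointFamily : Σ (List (Block cs)) λ F → IsDF cs F × DoublyDisjoint cs F
  doublyDisjointFamily =
    family , (λ g → trans (cong (G.count g) diffs-family) (count-differences g)) ,
    family′ , (λ g → trans (cong (G.count g) diffs-family′) (count-differences g)) ,
    family′-stronglyEquivalent , count-elements

theorem9p2 : (n : ℕ) → 1 < n
    → (∀ q → IsComponent q n → q % 4 ≡ 1)
    → (cs : List Comp) → ListsComponentsOf cs n
    → Σ (List (Block cs)) λ F → IsDF cs F × DoublyDisjoint cs F
theorem9p2 n _ components≡1 cs (listed , _ , _) =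
  Construction.doublyDisjointFamily cs
    (V-isGaussianModule cs λ c c∈cs → proj₁ (listed c c∈cs) , components≡1 (qOf c) (proj₂ (listed c c∈cs)))
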